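{- (i) For every $n\ge1$ and every integer $i\ge0$ there is a bijection $\xi$ from $\{s\in\mathcal{A}_n\cap\mathcal{S}_4:\mathsf{ealm}(s)=i\}$ onto $\{(s,i): s\in\mathcal{A}_n\setminus\mathcal{P},\ i<\mathsf{ealm}(s)\}$ such that if $\xi(s)=(s^*,i)$ then $\mathsf{asc}(s)=\mathsf{asc}(s^*)$, $\mathsf{rep}(s)=\mathsf{rep}(s^*)$, $\mathsf{max}(s)=\mathsf{max}(s^*)-1$ and $\mathsf{zero}(s)=\mathsf{zero}(s^*)+\chi(i=0)$. (ii) With $F(t;x,q,w,u,z)=\sum_{s\in\mathcal{A},\,|s|>\mathsf{max}(s)}t^{|s|}x^{\mathsf{rep}(s)}q^{\mathsf{max}(s)}w^{\mathsf{ealm}(s)}u^{\mathsf{asc}(s)}z^{\mathsf{zero}(s)}$, $$\sum_{s\in\mathcal{S}_4}t^{|s|}x^{\mathsf{rep}(s)}q^{\mathsf{max}(s)}w^{\mathsf{ealm}(s)}u^{\mathsf{asc}(s)}z^{\mathsf{zero}(s)}=\frac{(1-qut)(w+z-wz)}{q(1-w)}F(t;x,q,1,u,z)-\frac{1-qut}{q(1-w)}F(t;x,q,w,u,z)-\Big(\frac1q-ut\Big)(z-1)F(t;x,q,0,u,z).$$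
   Context: An inversion sequence of length $n$ is $s=(s_1,\dots,s_n)$ with $0\le s_i<i$; $|s|$ is its length. $\mathsf{asc}(s)=|\{i\in[n-1]:s_i<s_{i+1}\}|$; $\mathsf{rep}(s)=n-|\{s_1,\dots,s_n\}|$; $\mathsf{zero}(s)=|\{i:s_i=0\}|$; $\mathsf{max}(s)=|\{i:s_i=i-1\}|$. An ascent sequence is an inversion sequence with $s_i\le\mathsf{asc}(s_1,\dots,s_{i-1})+1$ for $2\le i\le n$; $\mathcal{A}_n$ is the set of ascent sequences of length $n$ and $\mathcal{A}$ the set of all ascent sequences. For $s$ with $p=\mathsf{max}(s)<|s|$, $\mathsf{ealm}(s)=s_{p+1}$; $\mathsf{ealm}(0,1,\dots,n-1)=0$. $\mathcal{P}$ is the set of ascent sequences in which $\mathsf{max}(s)-1$ appears exactly once. $\mathcal{S}_4$ is the set of ascent sequences $s$ with $p=\mathsf{max}(s)$, $|s|\ge p+2$, $s_{p+1}<s_{p+2}$, and $p\in\{s_i:p+2\le i\le|s|\}$. $\chi(S)=1$ if statement $S$ is true and $0$ otherwise. Power series are formal in $t$, with $0^0=1$ when substituting $w=0$. -}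

module Defs where

open import Level using (Level)
open import Data.Bool using (Bool; true; false; _∧_; if_then_else_; T; T?; not)
open import Data.Nat using (ℕ; zero; suc; _∸_; _≡ᵇ_; _<ᵇ_; _≤ᵇ_)
open import Data.Nat.Properties using (_≟_)
open import Data.Nat as N using ()
open import Data.List using (List; []; _∷_; length; filter; map; concatMap; upTo; drop; deduplicate; foldr; _++_; [_]; reverse)
open import Data.List.Membership.DecPropositional _≟_ using (_∈?_)
open import Relation.Nullary.Decidable using (does)
open import Relation.Unary using (Pred)
open import Data.Product using (Σ; _×_; _,_; proj₁)
open import Relation.Binary.PropositionalEquality using (_≡_)
open import Algebra.Bundles using (CommutativeRing)

-- Sequences are lists of naturals; the head is s₁.

count : ℕ → List ℕ → ℕ
count k []       = 0
count k (x ∷ xs) = (if x ≡ᵇ k then 1 else 0) N.+ count k xs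

zeroS : List ℕ → ℕ
zeroS s = count 0 s

asc : List ℕ → ℕ
asc []           = 0
asc (x ∷ [])     = 0
asc (x ∷ y ∷ ys) = (if x <ᵇ y then 1 else 0) N.+ asc (y ∷ ys)

rep : List ℕ → ℕ
rep s = length s ∸ length (deduplicate _≟_ s)

-- max(s) = |{i : s_i = i - 1}|   (k is the 0-based position, i = k+1)
maxFrom : ℕ → List ℕ → ℕ
maxFrom k []       = 0
maxFrom k (x ∷ xs) = (if x ≡ᵇ k then 1 else 0) N.+ maxFrom (suc k) xs

maxS : List ℕ → ℕ
maxS s = maxFrom 0 s

-- 0-based lookup with default 0
at : List ℕ → ℕ → ℕ
at []       _       = 0
at (x ∷ xs) zero    = x
at (x ∷ xs) (suc k) = at xs k

ealm : List ℕ → ℕ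
ealm s = if maxS s <ᵇ length s then at s (maxS s) else 0

-- inversion sequence: 0 ≤ s_i < i (k the 0-based position, i = k+1)
isInvFrom : ℕ → List ℕ → Bool
isInvFrom k []       = true
isInvFrom k (x ∷ xs) = (x ≤ᵇ k) ∧ isInvFrom (suc k) xs

isInv : List ℕ → Bool
isInv s = isInvFrom 0 s

-- ascent condition: s_i ≤ asc(s_1,…,s_{i-1}) + 1 for 2 ≤ i ≤ n.
-- We walk left to right keeping the previous entry and asc of the prefix.
ascCondFrom : ℕ → ℕ → List ℕ → Bool
ascCondFrom prev a []       = true
ascCondFrom prev a (x ∷ xs) =
  (x ≤ᵇ suc a) ∧ ascCondFrom x (a N.+ (if prev <ᵇ x then 1 else 0)) xs

isAscent : List ℕ → Bool
isAscent []       = true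
isAscent (x ∷ xs) = isInv (x ∷ xs) ∧ ascCondFrom x 0 xs

invSeqs : ℕ → List (List ℕ)
invSeqs zero    = [] ∷ []
invSeqs (suc n) = concatMap (λ s → map (λ v → s ++ [ v ]) (upTo (suc n))) (invSeqs n)

ascSeqs : ℕ → List (List ℕ)
ascSeqs n = filter (λ s → T? (isAscent s)) (invSeqs n)

inP : List ℕ → Bool
inP s = count (maxS s ∸ 1) s ≡ᵇ 1

inS4 : List ℕ → Bool
inS4 s = (suc (suc p) ≤ᵇ length s) ∧ (at s p <ᵇ at s (suc p))
         ∧ does (p ∈? drop (suc p) s)
  where p = maxS s

-- Sets used in part (i) (membership as Boolean tests, hence proof-irrelevant)

IsAsc : List ℕ → Set
IsAsc s = isAscent s ≡ true

Dom : ℕ → ℕ → Set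
Dom n i = Σ (List ℕ) λ s → IsAsc s × length s ≡ n × inS4 s ≡ true × ealm s ≡ i

Cod : ℕ → ℕ → Set
Cod n i = Σ (List ℕ × ℕ) λ { (s , j) →
  IsAsc s × length s ≡ n × inP s ≡ false × j ≡ i × (j <ᵇ ealm s) ≡ true }

χ : Bool → ℕ
χ true  = 1
χ false = 0

-- Part (ii): coefficients of t^n, in an arbitrary commutative ring

module GF {c ℓ : Level} (R : CommutativeRing c ℓ) where
  open CommutativeRing R

  pow : Carrier → ℕ → Carrier
  pow a zero    = 1#
  pow a (suc k) = a * pow a k

  sumL : List Carrier → Carrier
  sumL = foldr _+_ 0#

  wt : (x q w u z : Carrier) → List ℕ → Carrier
  wt x q w u z s = pow x (rep s) * pow q (maxS s) * pow w (ealm s)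
                   * pow u (asc s) * pow z (zeroS s)

  Fc : (x q w u z : Carrier) → ℕ → Carrier
  Fc x q w u z n =
    sumL (map (wt x q w u z)
      (filter (λ s → T? (maxS s <ᵇ length s)) (ascSeqs n)))

  S4c : (x q w u z : Carrier) → ℕ → Carrier
  S4c x q w u z n =
    sumL (map (wt x q w u z)
      (filter (λ s → T? (inS4 s)) (ascSeqs n)))

  -- [t^n] (t · G) = [t^{n-1}] G, and 0 for n = 0
  shift : (ℕ → Carrier) → ℕ → Carrier
  shift g zero    = 0#
  shift g (suc n) = g n

  oneMinusQUt : (q u : Carrier) → (ℕ → Carrier) → ℕ → Carrier
  oneMinusQUt q u g n = g n - q * u * shift g n

  -- Part (ii) at coefficient t^n, after multiplying both sides by q(1-w):
  -- q(1-w)·Σ_{𝒮₄} = (w+z-wz)(1-qut)F(…,1,…) - (1-qut)F(…,w,…)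
  --                 - (z-1)(1-w)(1-qut)F(…,0,…)
  S4Identity : (x q w u z : Carrier) (n : ℕ) → Set ℓ
  S4Identity x q w u z n =
    q * (1# - w) * S4c x q w u z n
    ≈ (w + z - w * z) * oneMinusQUt q u (Fc x q 1# u z) n
      - oneMinusQUt q u (Fc x q w u z) n
      - (z - 1#) * (1# - w) * oneMinusQUt q u (Fc x q 0# u z) n

module Submission where

-- An ascent sequence s with p = max(s) < |s| is a staircase 0 1 … p-1 followed by s_{p+1} < p and a tail.
-- (i) For s ∈ 𝒮₄ with ealm(s) = j, overwriting s_{p+1} by p gives s* with max p + 1 and ealm(s*) = s_{p+2} > j;
-- since p occurs again later, s* ∉ 𝒫. Ascents and the set of values are unchanged, and a zero is lost iff j = 0.
-- (ii) For s ∈ 𝒫, deleting the unique entry p - 1 and lowering the larger entries by one is a bijection onto the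
-- summands of F one shorter, losing exactly one ascent and one fixed point; so the 𝒫-part of F is qut·F and
-- (1 - qut)F sums over the sequences outside 𝒫. By (i), the 𝒮₄-sum is q⁻¹ times this sum with w^e replaced by
-- z + w + … + w^{e-1} (e = ealm), and (1 - w)(z + w + … + w^{e-1}) = (w + z - wz) - w^e - (z - 1)(1 - w)0^e.

open import Defs
open import Level using (Level)
open import Algebra.Bundles using (CommutativeRing)

module Sequences where

  open import Data.Bool using (Bool; true; false; _∧_; if_then_else_; T?; not)
  open import Data.Bool.Properties using (∧-conicalˡ; ∧-conicalʳ; T-≡; T-not-≡)
  open import Data.Nat using (ℕ; zero; suc; _+_; _∸_; _≤_; _<_; z≤n; s≤s; _≡ᵇ_; _<ᵇ_; _≤ᵇ_)
  open import Data.Nat.Properties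
  open import Data.List using (List; []; _∷_; _∷ʳ_; length; map; filter; concatMap; upTo; downFrom; drop; deduplicate; _++_; [_])
  open import Data.List.Properties using (++-identityʳ; length-map; map-++; length-++; ∷ʳ-injective)
  open import Data.List.Membership.Propositional using (_∈_; _∉_)
  open import Data.List.Membership.Propositional.Properties
    using (∈-++⁺ˡ; ∈-++⁺ʳ; ∈-++⁻; ∈-map⁺; ∈-map⁻; ∈-filter⁺; ∈-filter⁻; ∈-upTo⁺; ∈-upTo⁻; ∈-downFrom⁺; ∈-downFrom⁻; deduplicate-∈⇔)
  open import Data.List.Membership.DecPropositional _≟_ using (_∈?_)
  open import Data.List.Relation.Unary.Any using (here; there)
  open import Data.List.Relation.Unary.All as All using (All; []; _∷_)
  open import Data.List.Relation.Unary.All.Properties using (¬Any⇒All¬; All¬⇒¬Any)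
  open import Data.List.Relation.Unary.Unique.Propositional using (Unique)
  open import Data.List.Relation.Unary.Unique.Propositional.Properties using (map⁺; ++⁺; filter⁺; upTo⁺; downFrom⁺)
  open import Data.List.Reverse using (Reverse; []; _∶_∶ʳ_; reverseView)
  open import Data.List.Relation.Unary.AllPairs using ([]; _∷_)
  open import Data.Product using (Σ; _×_; _,_; proj₁; proj₂; uncurry)
  open import Data.Sum using (inj₁; inj₂)
  open import Data.Empty using (⊥; ⊥-elim)
  open import Relation.Nullary using (Dec; yes; no; does)
  open import Relation.Nullary.Decidable using (dec-true)
  open import Data.List.Relation.Unary.Unique.DecPropositional.Properties _≟_ using (deduplicate-!)
  open import Data.List.Membership.Propositional.Properties.WithK using (unique∧set⇒bag)
  open import Data.List.Relation.Binary.BagAndSetEquality using (∼bag⇒↭)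
  open import Data.List.Relation.Binary.Permutation.Propositional using (_↭_; ↭⇒↭ₛ′)
  open import Data.List.Relation.Binary.Permutation.Propositional.Properties using (↭-length) renaming (map⁺ to ↭-map⁺)
  open import Relation.Binary.PropositionalEquality hiding ([_])
  open import Relation.Binary.Definitions using (tri<; tri≈; tri>)
  open import Function.Base using (_∘_)
  open import Function.Bundles using (_⇔_; mk⇔; Equivalence; _⤖_; mk↔ₛ′)
  open import Function.Properties.Inverse using (↔⇒⤖)
  open import Axiom.UniquenessOfIdentityProofs.WithK using (uip)

  <⇒<ᵇ≡true : ∀ {m n} → m < n → (m <ᵇ n) ≡ true
  <⇒<ᵇ≡true m<n = Equivalence.to T-≡ (<⇒<ᵇ m<n)

  <ᵇ≡true⇒< : ∀ m n → (m <ᵇ n) ≡ true → m < n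
  <ᵇ≡true⇒< m n h = <ᵇ⇒< m n (Equivalence.from T-≡ h)

  ≤⇒≤ᵇ≡true : ∀ {m n} → m ≤ n → (m ≤ᵇ n) ≡ true
  ≤⇒≤ᵇ≡true m≤n = Equivalence.to T-≡ (≤⇒≤ᵇ m≤n)

  ≤ᵇ≡true⇒≤ : ∀ m n → (m ≤ᵇ n) ≡ true → m ≤ n
  ≤ᵇ≡true⇒≤ m n h = ≤ᵇ⇒≤ m n (Equivalence.from T-≡ h)

  ≥⇒<ᵇ≡false : ∀ {m n} → n ≤ m → (m <ᵇ n) ≡ false
  ≥⇒<ᵇ≡false {m}     {zero}  _         = refl
  ≥⇒<ᵇ≡false {suc m} {suc n} (s≤s n≤m) = ≥⇒<ᵇ≡false n≤m

  >⇒≤ᵇ≡false : ∀ {m n} → n < m → (m ≤ᵇ n) ≡ false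
  >⇒≤ᵇ≡false {suc m} (s≤s n≤m) = ≥⇒<ᵇ≡false n≤m

  ≡ᵇ-refl : ∀ n → (n ≡ᵇ n) ≡ true
  ≡ᵇ-refl n = Equivalence.to T-≡ (≡⇒≡ᵇ n n refl)

  ≡ᵇ≡true⇒≡ : ∀ m n → (m ≡ᵇ n) ≡ true → m ≡ n
  ≡ᵇ≡true⇒≡ m n h = ≡ᵇ⇒≡ m n (Equivalence.from T-≡ h)

  ≢⇒≡ᵇ≡false : ∀ {m n} → m ≢ n → (m ≡ᵇ n) ≡ false
  ≢⇒≡ᵇ≡false {zero}  {zero}  m≢n = ⊥-elim (m≢n refl)
  ≢⇒≡ᵇ≡false {zero}  {suc n} _   = refl
  ≢⇒≡ᵇ≡false {suc m} {zero}  _   = refl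
  ≢⇒≡ᵇ≡false {suc m} {suc n} m≢n = ≢⇒≡ᵇ≡false (m≢n ∘ cong suc)

  does≡true⇒ : ∀ {P : Set} (P? : Dec P) → does P? ≡ true → P
  does≡true⇒ (yes p) _ = p

  ∧-intro : ∀ {a b} → a ≡ true → b ≡ true → a ∧ b ≡ true
  ∧-intro refl refl = refl

  ∧-elimˡ : ∀ {a b} → a ∧ b ≡ true → a ≡ true
  ∧-elimˡ = ∧-conicalˡ _ _

  ∧-elimʳ : ∀ {a b} → a ∧ b ≡ true → b ≡ true
  ∧-elimʳ = ∧-conicalʳ _ _

  -- Spelled as the summands of count, asc and maxFrom in Defs, so that it matches them definitionally.
  indicator : Bool → ℕ
  indicator b = if b then 1 else 0

  indicator≤1 : ∀ b → indicator b ≤ 1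
  indicator≤1 true  = ≤-refl
  indicator≤1 false = z≤n

  -- Staircase prefixes 0, 1, …, p - 1

  upFrom : ℕ → ℕ → List ℕ
  upFrom k zero    = []
  upFrom k (suc n) = k ∷ upFrom (suc k) n

  staircase : ℕ → List ℕ
  staircase = upFrom 0

  length-upFrom-++ : ∀ k n r → length (upFrom k n ++ r) ≡ n + length r
  length-upFrom-++ k zero    r = refl
  length-upFrom-++ k (suc n) r = cong suc (length-upFrom-++ (suc k) n r)

  drop-upFrom-++ : ∀ k n r → drop n (upFrom k n ++ r) ≡ r
  drop-upFrom-++ k zero    r = refl
  drop-upFrom-++ k (suc n) r = drop-upFrom-++ (suc k) n r

  drop-upFrom-++-∷ : ∀ k n c r → drop (suc n) (upFrom k n ++ c ∷ r) ≡ r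
  drop-upFrom-++-∷ k zero    c r = refl
  drop-upFrom-++-∷ k (suc n) c r = drop-upFrom-++-∷ (suc k) n c r

  at-upFrom-++ : ∀ k n c r → at (upFrom k n ++ c ∷ r) n ≡ c
  at-upFrom-++ k zero    c r = refl
  at-upFrom-++ k (suc n) c r = at-upFrom-++ (suc k) n c r

  at-upFrom-++-suc : ∀ k n c r → at (upFrom k n ++ c ∷ r) (suc n) ≡ at r 0
  at-upFrom-++-suc k zero    c r = refl
  at-upFrom-++-suc k (suc n) c r = at-upFrom-++-suc (suc k) n c r

  upFrom-suc-++ : ∀ k n r → upFrom k (suc n) ++ r ≡ upFrom k n ++ (k + n) ∷ r
  upFrom-suc-++ k zero    r = cong (λ v → v ∷ r) (sym (+-identityʳ k))
  upFrom-suc-++ k (suc n) r = cong (k ∷_) (trans (upFrom-suc-++ (suc k) n r) (cong (λ v → upFrom (suc k) n ++ v ∷ r) (sym (+-suc k n))))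

  maxFrom-upFrom-++ : ∀ k n r → maxFrom k (upFrom k n ++ r) ≡ n + maxFrom (k + n) r
  maxFrom-upFrom-++ k zero r = cong (λ i → maxFrom i r) (sym (+-identityʳ k))
  maxFrom-upFrom-++ k (suc n) r rewrite ≡ᵇ-refl k | maxFrom-upFrom-++ (suc k) n r | +-suc k n = refl

  isInvFrom-upFrom-++ : ∀ k n r → isInvFrom k (upFrom k n ++ r) ≡ isInvFrom (k + n) r
  isInvFrom-upFrom-++ k zero r rewrite +-identityʳ k = refl
  isInvFrom-upFrom-++ k (suc n) r rewrite ≤⇒≤ᵇ≡true (≤-refl {k}) | isInvFrom-upFrom-++ (suc k) n r | +-suc k n = refl

  -- Along the staircase every entry is an ascent, so asc of the prefix equals its last entry.
  ascCondFrom-upFrom-++ : ∀ k n r → ascCondFrom k k (upFrom (suc k) n ++ r) ≡ ascCondFrom (k + n) (k + n) r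
  ascCondFrom-upFrom-++ k zero r rewrite +-identityʳ k = refl
  ascCondFrom-upFrom-++ k (suc n) r
    rewrite <⇒<ᵇ≡true (n<1+n k) | +-comm k 1 | ascCondFrom-upFrom-++ (suc k) n r | +-suc k n = refl

  asc-upFrom-++ : ∀ k n y ys → asc (upFrom k (suc n) ++ y ∷ ys) ≡ n + (indicator ((k + n) <ᵇ y) + asc (y ∷ ys))
  asc-upFrom-++ k zero y ys rewrite +-identityʳ k = refl
  asc-upFrom-++ k (suc n) y ys rewrite <⇒<ᵇ≡true (n<1+n k) | asc-upFrom-++ (suc k) n y ys | +-suc k n = refl

  count-++ : ∀ v xs ys → count v (xs ++ ys) ≡ count v xs + count v ys
  count-++ v []       ys = refl
  count-++ v (x ∷ xs) ys = trans (cong (indicator (x ≡ᵇ v) +_) (count-++ v xs ys)) (sym (+-assoc (indicator (x ≡ᵇ v)) _ _))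

  count-upFrom-below : ∀ v k n → v < k → count v (upFrom k n) ≡ 0
  count-upFrom-below v k zero    v<k = refl
  count-upFrom-below v k (suc n) v<k rewrite ≢⇒≡ᵇ≡false (>⇒≢ v<k) = count-upFrom-below v (suc k) n (m<n⇒m<1+n v<k)

  count-upFrom-above : ∀ v k n → k + n ≤ v → count v (upFrom k n) ≡ 0
  count-upFrom-above v k zero    _ = refl
  count-upFrom-above v k (suc n) k+n<v rewrite +-suc k n | ≢⇒≡ᵇ≡false (<⇒≢ (≤-trans (s≤s (m≤m+n k n)) k+n<v)) =
    count-upFrom-above v (suc k) n k+n<v

  count-staircase-top : ∀ n → count n (staircase (suc n)) ≡ 1
  count-staircase-top n = begin
    count n (staircase (suc n))                 ≡⟨ cong (count n) (trans (sym (++-identityʳ _)) (upFrom-suc-++ 0 n [])) ⟩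
    count n (staircase n ++ [ n ])              ≡⟨ count-++ n (staircase n) [ n ] ⟩
    count n (staircase n) + count n [ n ]       ≡⟨ cong₂ _+_ (count-upFrom-above n 0 n ≤-refl) (cong (λ b → indicator b + 0) (≡ᵇ-refl n)) ⟩
    1                                           ∎
    where open ≡-Reasoning

  count-zero-staircase : ∀ n → count 0 (staircase (suc n)) ≡ 1
  count-zero-staircase n = cong suc (count-upFrom-below 0 1 n (s≤s z≤n))

  ∈-upFrom : ∀ k {n j} → k ≤ j → j < k + n → j ∈ upFrom k n
  ∈-upFrom k {zero}  k≤j j<k+0 = ⊥-elim (<-irrefl refl (≤-trans j<k+0 (≤-trans (≤-reflexive (+-identityʳ k)) k≤j)))
  ∈-upFrom k {suc n} {j} k≤j j<k+n with k ≟ j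
  ... | yes refl = here refl
  ... | no  k≢j  = there (∈-upFrom (suc k) (≤∧≢⇒< k≤j k≢j) (≤-trans j<k+n (≤-reflexive (+-suc k n))))

  -- Staircase decomposition of ascent sequences

  ascCondFrom⇒isInvFrom : ∀ prev a k xs → suc a ≤ k → ascCondFrom prev a xs ≡ true → isInvFrom k xs ≡ true
  ascCondFrom⇒isInvFrom prev a k []       _   _ = refl
  ascCondFrom⇒isInvFrom prev a k (x ∷ xs) a<k h =
    ∧-intro (≤⇒≤ᵇ≡true (≤-trans (≤ᵇ≡true⇒≤ x (suc a) (∧-elimˡ h)) a<k))
            (ascCondFrom⇒isInvFrom x _ (suc k) xs a'<k' (∧-elimʳ h))
    where
    a'<k' : suc (a + indicator (prev <ᵇ x)) ≤ suc k
    a'<k' = s≤s (≤-trans (+-monoʳ-≤ a (indicator≤1 (prev <ᵇ x))) (≤-trans (≤-reflexive (+-comm a 1)) a<k))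

  ascCondFrom⇒maxFrom≡0 : ∀ prev a k xs → suc a < k → ascCondFrom prev a xs ≡ true → maxFrom k xs ≡ 0
  ascCondFrom⇒maxFrom≡0 prev a k []       _    _ = refl
  ascCondFrom⇒maxFrom≡0 prev a k (x ∷ xs) 1+a<k h
    rewrite ≢⇒≡ᵇ≡false {x} {k} (<⇒≢ (≤-<-trans (≤ᵇ≡true⇒≤ x (suc a) (∧-elimˡ h)) 1+a<k)) =
    ascCondFrom⇒maxFrom≡0 x _ (suc k) xs 1+a'<k' (∧-elimʳ h)
    where
    1+a'<k' : suc (a + indicator (prev <ᵇ x)) < suc k
    1+a'<k' = s≤s (≤-<-trans (+-monoʳ-≤ a (indicator≤1 (prev <ᵇ x))) (≤-trans (≤-reflexive (cong suc (+-comm a 1))) 1+a<k))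

  -- The conditions on c ∷ r making staircase (suc n) ++ c ∷ r an ascent sequence with max exactly suc n.
  Tail : ℕ → ℕ → List ℕ → Set
  Tail n c r = c ≤ n × ascCondFrom c n r ≡ true

  module _ {n c : ℕ} {r : List ℕ} (tail : Tail n c r) where

    private
      s = staircase (suc n) ++ c ∷ r
      c≤n = proj₁ tail

    staircase-++-isAscent : isAscent s ≡ true
    staircase-++-isAscent = ∧-intro inv ac
      where
      c≤ᵇ1+n : (c ≤ᵇ suc n) ≡ true
      c≤ᵇ1+n = ≤⇒≤ᵇ≡true (m≤n⇒m≤1+n c≤n)
      ac-tail : ascCondFrom n n (c ∷ r) ≡ true
      ac-tail rewrite c≤ᵇ1+n | ≥⇒<ᵇ≡false c≤n | +-identityʳ n = proj₂ tail
      ac : ascCondFrom 0 0 (upFrom 1 n ++ c ∷ r) ≡ true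
      ac = trans (ascCondFrom-upFrom-++ 0 n (c ∷ r)) ac-tail
      inv : isInvFrom 1 (upFrom 1 n ++ c ∷ r) ≡ true
      inv = trans (isInvFrom-upFrom-++ 1 n (c ∷ r))
                  (∧-intro c≤ᵇ1+n (ascCondFrom⇒isInvFrom c n (2 + n) r (n≤1+n (suc n)) (proj₂ tail)))

    staircase-++-maxS : maxS s ≡ suc n
    staircase-++-maxS = begin
      maxS s                                                  ≡⟨ maxFrom-upFrom-++ 0 (suc n) (c ∷ r) ⟩
      suc n + (indicator (c ≡ᵇ suc n) + maxFrom (2 + n) r)    ≡⟨ cong (λ b → suc n + (indicator b + maxFrom (2 + n) r)) (≢⇒≡ᵇ≡false (<⇒≢ (s≤s c≤n))) ⟩
      suc n + maxFrom (2 + n) r                               ≡⟨ cong (suc n +_) (ascCondFrom⇒maxFrom≡0 c n (2 + n) r ≤-refl (proj₂ tail)) ⟩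
      suc n + 0                                               ≡⟨ +-identityʳ (suc n) ⟩
      suc n                                                   ∎
      where open ≡-Reasoning

    staircase-++-length : length s ≡ suc n + suc (length r)
    staircase-++-length = length-upFrom-++ 0 (suc n) (c ∷ r)

    staircase-++-maxS<ᵇlength : (maxS s <ᵇ length s) ≡ true
    staircase-++-maxS<ᵇlength =
      trans (cong₂ _<ᵇ_ staircase-++-maxS staircase-++-length) (<⇒<ᵇ≡true (m<m+n (suc n) (s≤s z≤n)))

    staircase-++-ealm : ealm s ≡ c
    staircase-++-ealm =
      trans (cong₂ (λ p b → if b then at s p else 0) staircase-++-maxS staircase-++-maxS<ᵇlength)
            (at-upFrom-++ 0 (suc n) c r)

  record StaircaseView (s : List ℕ) : Set where
    constructor staircase-view
    field
      {height} : ℕ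
      {entry}  : ℕ
      {rest}   : List ℕ
      shape    : s ≡ staircase (suc height) ++ entry ∷ rest
      tail     : Tail height entry rest

  private
    staircaseView-after : ∀ k ys → ascCondFrom k k ys ≡ true →
      (maxS (staircase (suc k) ++ ys) <ᵇ length (staircase (suc k) ++ ys)) ≡ true → StaircaseView (staircase (suc k) ++ ys)
    staircaseView-after k [] _ lt = ⊥-elim (<-irrefl max≡length (<ᵇ≡true⇒< _ _ lt))
      where
      max≡length : maxS (staircase (suc k) ++ []) ≡ length (staircase (suc k) ++ [])
      max≡length = trans (maxFrom-upFrom-++ 0 (suc k) []) (sym (length-upFrom-++ 0 (suc k) []))
    staircaseView-after k (y ∷ ys) h lt with y ≟ suc k
    ... | yes refl = subst StaircaseView (sym extend) (staircaseView-after (suc k) ys h' (subst (λ s → (maxS s <ᵇ length s) ≡ true) extend lt))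
      where
      extend : staircase (suc k) ++ suc k ∷ ys ≡ staircase (2 + k) ++ ys
      extend = sym (upFrom-suc-++ 0 (suc k) ys)
      h' : ascCondFrom (suc k) (suc k) ys ≡ true
      h' = subst (λ a → ascCondFrom (suc k) a ys ≡ true)
                 (trans (cong (λ b → k + indicator b) (<⇒<ᵇ≡true (n<1+n k))) (+-comm k 1)) (∧-elimʳ h)
    ... | no y≢1+k = staircase-view refl (y≤k , h')
      where
      y≤k : y ≤ k
      y≤k = ≤-pred (≤∧≢⇒< (≤ᵇ≡true⇒≤ y (suc k) (∧-elimˡ h)) y≢1+k)
      h' : ascCondFrom y k ys ≡ true
      h' = subst (λ a → ascCondFrom y a ys ≡ true)
                 (trans (cong (λ b → k + indicator b) (≥⇒<ᵇ≡false y≤k)) (+-identityʳ k)) (∧-elimʳ h)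

  staircaseView : ∀ s → isAscent s ≡ true → (maxS s <ᵇ length s) ≡ true → StaircaseView s
  staircaseView []           _  ()
  staircaseView (zero ∷ xs)  h  lt = staircaseView-after 0 xs (∧-elimʳ h) lt
  staircaseView (suc x ∷ xs) () _

  ∈⇒count>0 : ∀ {v xs} → v ∈ xs → 0 < count v xs
  ∈⇒count>0 {v} {x ∷ xs} (here refl) rewrite ≡ᵇ-refl v = s≤s z≤n
  ∈⇒count>0 {v} {x ∷ xs} (there v∈xs) = <-≤-trans (∈⇒count>0 v∈xs) (m≤n+m (count v xs) (indicator (x ≡ᵇ v)))

  ∉⇒count≡0 : ∀ {v} xs → v ∉ xs → count v xs ≡ 0
  ∉⇒count≡0     []       _    = refl
  ∉⇒count≡0 {v} (x ∷ xs) v∉ rewrite ≢⇒≡ᵇ≡false {x} {v} (λ x≡v → v∉ (here (sym x≡v))) = ∉⇒count≡0 xs (v∉ ∘ there)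

  count≢0⇒∈ : ∀ {v} xs → (count v xs ≡ᵇ 0) ≡ false → v ∈ xs
  count≢0⇒∈ {v} xs h with v ∈? xs
  ... | yes v∈xs = v∈xs
  ... | no  v∉xs with () ← trans (sym h) (cong (_≡ᵇ 0) (∉⇒count≡0 xs v∉xs))

  ∈⇒count≢0 : ∀ {v xs} → v ∈ xs → (count v xs ≡ᵇ 0) ≡ false
  ∈⇒count≢0 v∈xs = ≢⇒≡ᵇ≡false (>⇒≢ (∈⇒count>0 v∈xs))

  private
    inS4At : List ℕ → ℕ → Bool
    inS4At s p = (suc (suc p) ≤ᵇ length s) ∧ (at s p <ᵇ at s (suc p)) ∧ does (p ∈? drop (suc p) s)

  staircase-++-inS4 : ∀ {n c b r} → Tail n c (b ∷ r) →
    inS4 (staircase (suc n) ++ c ∷ b ∷ r) ≡ (c <ᵇ b) ∧ does (suc n ∈? (b ∷ r))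
  staircase-++-inS4 {n} {c} {b} {r} tail = trans (cong (inS4At s) (staircase-++-maxS tail))
    (cong₂ _∧_ long-enough
      (cong₂ _∧_ (cong₂ _<ᵇ_ (at-upFrom-++ 0 (suc n) c (b ∷ r)) (at-upFrom-++-suc 0 (suc n) c (b ∷ r)))
                 (cong (λ xs → does (suc n ∈? xs)) (drop-upFrom-++-∷ 0 (suc n) c (b ∷ r)))))
    where
    s = staircase (suc n) ++ c ∷ b ∷ r
    long-enough : (3 + n ≤ᵇ length s) ≡ true
    long-enough = trans (cong (3 + n ≤ᵇ_) (staircase-++-length tail))
      (≤⇒≤ᵇ≡true (≤-trans (≤-reflexive (cong suc (+-comm 2 n))) (s≤s (+-monoʳ-≤ n (s≤s (s≤s z≤n))))))

  staircase-++-[]-inS4 : ∀ {n c} → Tail n c [] → inS4 (staircase (suc n) ++ [ c ]) ≡ false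
  staircase-++-[]-inS4 {n} {c} tail =
    trans (cong (inS4At s) (staircase-++-maxS tail))
          (cong (_∧ ((at s (suc n) <ᵇ at s (2 + n)) ∧ does (suc n ∈? drop (2 + n) s))) too-short)
    where
    s = staircase (suc n) ++ [ c ]
    too-short : (3 + n ≤ᵇ length s) ≡ false
    too-short = trans (cong (3 + n ≤ᵇ_) (staircase-++-length tail)) (>⇒≤ᵇ≡false (≤-reflexive (cong (2 +_) (+-comm n 1))))

  staircase-++-inP : ∀ {n c r} → Tail n c r → inP (staircase (suc n) ++ c ∷ r) ≡ (count n (c ∷ r) ≡ᵇ 0)
  staircase-++-inP {n} {c} {r} tail =
    trans (cong (λ p → count (p ∸ 1) s ≡ᵇ 1) (staircase-++-maxS tail))
          (cong (_≡ᵇ 1) (trans (count-++ n (staircase (suc n)) (c ∷ r)) (cong (_+ count n (c ∷ r)) (count-staircase-top n))))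
    where s = staircase (suc n) ++ c ∷ r

  length-deduplicate-unique : ∀ {us xs : List ℕ} → Unique us → (∀ {x} → x ∈ us ⇔ x ∈ xs) →
    length (deduplicate _≟_ xs) ≡ length us
  length-deduplicate-unique {us} {xs} us! us≈xs = ↭-length (∼bag⇒↭ (unique∧set⇒bag (deduplicate-! xs) us!
    (mk⇔ (λ p → Equivalence.from us≈xs (Equivalence.from (deduplicate-∈⇔ _≟_) p))
         (λ p → Equivalence.to (deduplicate-∈⇔ _≟_) (Equivalence.to us≈xs p)))))

  length-deduplicate-cong : ∀ {xs ys : List ℕ} → (∀ {x} → x ∈ xs ⇔ x ∈ ys) →
    length (deduplicate _≟_ xs) ≡ length (deduplicate _≟_ ys)
  length-deduplicate-cong {xs} {ys} xs≈ys = length-deduplicate-unique (deduplicate-! ys)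
    (mk⇔ (λ p → Equivalence.from xs≈ys (Equivalence.from (deduplicate-∈⇔ _≟_) p))
         (λ p → Equivalence.to (deduplicate-∈⇔ _≟_) (Equivalence.to xs≈ys p)))

  ∈-++-∷-replace : ∀ {y z x : ℕ} (xs ys : List ℕ) → y ∈ xs ++ z ∷ ys → x ∈ xs ++ y ∷ ys → x ∈ xs ++ z ∷ ys
  ∈-++-∷-replace xs ys y∈ x∈ with ∈-++⁻ xs x∈
  ... | inj₁ x∈xs          = ∈-++⁺ˡ x∈xs
  ... | inj₂ (here refl)   = y∈
  ... | inj₂ (there x∈ys)  = ∈-++⁺ʳ xs (there x∈ys)

  -- Part (i): the bijection ξ

  -- The map ξ of part (i) on sequences; demote t j is its inverse.
  promote : List ℕ → List ℕ
  promote s = staircase (suc (maxS s)) ++ drop (suc (maxS s)) s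

  demote : List ℕ → ℕ → List ℕ
  demote t j = staircase (maxS t ∸ 1) ++ j ∷ drop (maxS t) t

  -- s = 0 … n j c r ∈ 𝒮₄ with ealm(s) = j corresponds to t = 0 … n (n+1) c r ∉ 𝒫 with j < ealm(t) = c.
  S4Shape : ℕ → ℕ → ℕ → List ℕ → Set
  S4Shape n c j r = Tail (suc n) c r × j < c × suc n ∈ c ∷ r

  s4Seq : ℕ → ℕ → ℕ → List ℕ → List ℕ
  s4Seq n c j r = staircase (suc n) ++ j ∷ c ∷ r

  promotedSeq : ℕ → ℕ → List ℕ → List ℕ
  promotedSeq n c r = staircase (2 + n) ++ c ∷ r

  module S4ShapeProperties {n c j : ℕ} {r : List ℕ} (shape : S4Shape n c j r) where

    private
      s = s4Seq n c j r
      t = promotedSeq n c r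

    tail-t : Tail (suc n) c r
    tail-t = proj₁ shape

    j<c : j < c
    j<c = proj₁ (proj₂ shape)

    j≤n : j ≤ n
    j≤n = ≤-pred (≤-trans j<c (proj₁ tail-t))

    tail-s : Tail n j (c ∷ r)
    tail-s = j≤n , ∧-intro (≤⇒≤ᵇ≡true (proj₁ tail-t))
      (subst (λ a → ascCondFrom c a r ≡ true)
             (sym (trans (cong (λ b → n + indicator b) (<⇒<ᵇ≡true j<c)) (+-comm n 1))) (proj₂ tail-t))

    maxS-s : maxS s ≡ suc n
    maxS-s = staircase-++-maxS tail-s

    maxS-t : maxS t ≡ 2 + n
    maxS-t = staircase-++-maxS tail-t

    promote-s : promote s ≡ t
    promote-s = trans (cong (λ p → staircase (suc p) ++ drop (suc p) s) maxS-s)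
                      (cong (staircase (2 + n) ++_) (drop-upFrom-++-∷ 0 (suc n) j (c ∷ r)))

    demote-t : demote t j ≡ s
    demote-t = trans (cong (λ p → staircase (p ∸ 1) ++ j ∷ drop p t) maxS-t)
                     (cong (λ xs → staircase (suc n) ++ j ∷ xs) (drop-upFrom-++ 0 (2 + n) (c ∷ r)))

    length-s≡length-t : length s ≡ length t
    length-s≡length-t = trans (staircase-++-length tail-s)
      (trans (+-suc (suc n) (suc (length r))) (sym (staircase-++-length tail-t)))

    inS4-s : inS4 s ≡ true
    inS4-s = trans (staircase-++-inS4 tail-s)
                   (∧-intro (<⇒<ᵇ≡true j<c) (dec-true (suc n ∈? (c ∷ r)) (proj₂ (proj₂ shape))))

    inP-t : inP t ≡ false
    inP-t = trans (staircase-++-inP tail-t) (∈⇒count≢0 (proj₂ (proj₂ shape)))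

    asc-s≡asc-t : asc s ≡ asc t
    asc-s≡asc-t = begin
      asc s                                                          ≡⟨ asc-upFrom-++ 0 n j (c ∷ r) ⟩
      n + (indicator (n <ᵇ j) + (indicator (j <ᵇ c) + asc (c ∷ r)))  ≡⟨ cong₂ (λ b b′ → n + (indicator b + (indicator b′ + asc (c ∷ r))))
                                                                                (≥⇒<ᵇ≡false j≤n) (<⇒<ᵇ≡true j<c) ⟩
      n + suc (asc (c ∷ r))                                          ≡⟨ +-suc n (asc (c ∷ r)) ⟩
      suc n + asc (c ∷ r)                                            ≡⟨ cong (λ b → suc n + (indicator b + asc (c ∷ r)))
                                                                                (sym (≥⇒<ᵇ≡false (proj₁ tail-t))) ⟩
      suc n + (indicator (suc n <ᵇ c) + asc (c ∷ r))                 ≡⟨ asc-upFrom-++ 0 (suc n) c r ⟨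
      asc t                                                          ∎
      where open ≡-Reasoning

    -- s and t have the same values: j already occurs in the staircase of t, and n + 1 in c ∷ r.
    rep-s≡rep-t : rep s ≡ rep t
    rep-s≡rep-t = cong₂ _∸_ length-s≡length-t (length-deduplicate-cong (mk⇔ s⊆t t⊆s))
      where
      t≡ : t ≡ staircase (suc n) ++ suc n ∷ c ∷ r
      t≡ = upFrom-suc-++ 0 (suc n) (c ∷ r)
      s⊆t : ∀ {x} → x ∈ s → x ∈ t
      s⊆t {x} x∈ = subst (x ∈_) (sym t≡) (∈-++-∷-replace (staircase (suc n)) (c ∷ r) (∈-++⁺ˡ (∈-upFrom 0 z≤n (s≤s j≤n))) x∈)
      t⊆s : ∀ {x} → x ∈ t → x ∈ s
      t⊆s {x} x∈ = ∈-++-∷-replace (staircase (suc n)) (c ∷ r) (∈-++⁺ʳ (staircase (suc n)) (there (proj₂ (proj₂ shape)))) (subst (x ∈_) t≡ x∈)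

    zeroS-s≡zeroS-t+χ : zeroS s ≡ zeroS t + χ (j ≡ᵇ 0)
    zeroS-s≡zeroS-t+χ = begin
      zeroS s                                                           ≡⟨ count-++ 0 (staircase (suc n)) (j ∷ c ∷ r) ⟩
      count 0 (staircase (suc n)) + count 0 (j ∷ c ∷ r)                 ≡⟨ cong (_+ count 0 (j ∷ c ∷ r)) (count-zero-staircase n) ⟩
      1 + (indicator (j ≡ᵇ 0) + count 0 (c ∷ r))                        ≡⟨ swap (j ≡ᵇ 0) (count 0 (c ∷ r)) ⟩
      (1 + count 0 (c ∷ r)) + χ (j ≡ᵇ 0)                                ≡⟨ cong (λ k → (k + count 0 (c ∷ r)) + χ (j ≡ᵇ 0)) (count-zero-staircase (suc n)) ⟨
      (count 0 (staircase (2 + n)) + count 0 (c ∷ r)) + χ (j ≡ᵇ 0)      ≡⟨ cong (_+ χ (j ≡ᵇ 0)) (count-++ 0 (staircase (2 + n)) (c ∷ r)) ⟨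
      zeroS t + χ (j ≡ᵇ 0)                                              ∎
      where
      open ≡-Reasoning
      swap : ∀ b k → 1 + (indicator b + k) ≡ (1 + k) + χ b
      swap true  k = cong suc (+-comm 1 k)
      swap false k = sym (+-identityʳ (suc k))

  record S4View (s : List ℕ) : Set where
    constructor s4-view
    field
      {n c j} : ℕ
      {r}     : List ℕ
      shape   : S4Shape n c j r
      s≡      : s ≡ s4Seq n c j r

  s4View : ∀ s → isAscent s ≡ true → inS4 s ≡ true → S4View s
  s4View s asc-s s4 with staircaseView s asc-s max<length
    where
    max<length : (maxS s <ᵇ length s) ≡ true
    max<length = <⇒<ᵇ≡true (≤-trans (n≤1+n _) (≤ᵇ≡true⇒≤ (2 + maxS s) (length s) (∧-elimˡ s4)))
  ... | staircase-view {rest = []}    refl tail with () ← trans (sym (staircase-++-[]-inS4 tail)) s4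
  ... | staircase-view {height = n} {entry = j} {rest = c ∷ r} refl tail = s4-view (tail-t , j<c , n+1∈c∷r) refl
    where
    ascent-and-member : ((j <ᵇ c) ∧ does (suc n ∈? (c ∷ r))) ≡ true
    ascent-and-member = trans (sym (staircase-++-inS4 tail)) s4
    j<c : j < c
    j<c = <ᵇ≡true⇒< j c (∧-elimˡ ascent-and-member)
    n+1∈c∷r : suc n ∈ c ∷ r
    n+1∈c∷r = does≡true⇒ (suc n ∈? (c ∷ r)) (∧-elimʳ {j <ᵇ c} ascent-and-member)
    tail-t : Tail (suc n) c r
    tail-t = ≤ᵇ≡true⇒≤ c (suc n) (∧-elimˡ (proj₂ tail)) ,
             subst (λ a → ascCondFrom c a r ≡ true)
                   (trans (cong (λ b → n + indicator b) (<⇒<ᵇ≡true j<c)) (+-comm n 1)) (∧-elimʳ (proj₂ tail))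

  record NonPView (t : List ℕ) (j : ℕ) : Set where
    constructor nonP-view
    field
      {n c}  : ℕ
      {r}    : List ℕ
      shape  : S4Shape n c j r
      t≡     : t ≡ promotedSeq n c r

  nonPView : ∀ t j → isAscent t ≡ true → inP t ≡ false → (j <ᵇ ealm t) ≡ true → NonPView t j
  nonPView t j asc-t nonP j<ealm with staircaseView t asc-t max<length
    where
    -- If max(t) = |t| then ealm(t) = 0, and j < 0 is impossible.
    max<length : (maxS t <ᵇ length t) ≡ true
    max<length with maxS t <ᵇ length t
    ... | true  = refl
    ... | false = j<ealm
  ... | staircase-view {height = h} {entry = c} {rest = r} refl tail = build h refl
    where
    j<c : j < c
    j<c = <ᵇ≡true⇒< j c (trans (cong (j <ᵇ_) (sym (staircase-++-ealm tail))) j<ealm)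
    h∈c∷r : h ∈ c ∷ r
    h∈c∷r = count≢0⇒∈ (c ∷ r) (trans (sym (staircase-++-inP tail)) nonP)
    build : ∀ m → m ≡ h → NonPView (staircase (suc h) ++ c ∷ r) j
    build zero    refl with () ← ≤-trans j<c (proj₁ tail)
    build (suc n) refl = nonP-view (tail , j<c , h∈c∷r) refl

  module S4ViewProperties {s : List ℕ} (V : S4View s) where
    open S4View V
    open S4ShapeProperties shape

    promote≡ : promote s ≡ promotedSeq n c r
    promote≡ = trans (cong promote s≡) promote-s

    promote-isAscent : isAscent (promote s) ≡ true
    promote-isAscent = subst (λ xs → isAscent xs ≡ true) (sym promote≡) (staircase-++-isAscent tail-t)

    length-promote : length (promote s) ≡ length s
    length-promote = trans (cong length promote≡) (trans (sym length-s≡length-t) (cong length (sym s≡)))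

    promote-inP : inP (promote s) ≡ false
    promote-inP = subst (λ xs → inP xs ≡ false) (sym promote≡) inP-t

    ealm-s : ealm s ≡ j
    ealm-s = trans (cong ealm s≡) (staircase-++-ealm tail-s)

    ealm<ᵇealm-promote : (ealm s <ᵇ ealm (promote s)) ≡ true
    ealm<ᵇealm-promote = trans (cong₂ (λ xs ys → ealm xs <ᵇ ealm ys) s≡ promote≡)
      (trans (cong₂ _<ᵇ_ (staircase-++-ealm tail-s) (staircase-++-ealm tail-t)) (<⇒<ᵇ≡true j<c))

    demote-promote : demote (promote s) (ealm s) ≡ s
    demote-promote = trans (cong₂ demote promote≡ ealm-s) (trans demote-t (sym s≡))

    asc-promote : asc s ≡ asc (promote s)
    asc-promote = trans (cong asc s≡) (trans asc-s≡asc-t (cong asc (sym promote≡)))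

    rep-promote : rep s ≡ rep (promote s)
    rep-promote = trans (cong rep s≡) (trans rep-s≡rep-t (cong rep (sym promote≡)))

    maxS-promote : suc (maxS s) ≡ maxS (promote s)
    maxS-promote = trans (cong (suc ∘ maxS) s≡) (trans (cong suc maxS-s) (trans (sym maxS-t) (cong maxS (sym promote≡))))

    zeroS-promote : zeroS s ≡ zeroS (promote s) + χ (ealm s ≡ᵇ 0)
    zeroS-promote = trans (cong zeroS s≡)
      (trans zeroS-s≡zeroS-t+χ (cong₂ (λ xs k → zeroS xs + χ (k ≡ᵇ 0)) (sym promote≡) (sym ealm-s)))

  module NonPViewProperties {t : List ℕ} {j : ℕ} (V : NonPView t j) where
    open NonPView V
    open S4ShapeProperties shape

    demote≡ : demote t j ≡ s4Seq n c j r
    demote≡ = trans (cong (λ xs → demote xs j) t≡) demote-t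

    demote-isAscent : isAscent (demote t j) ≡ true
    demote-isAscent = subst (λ xs → isAscent xs ≡ true) (sym demote≡) (staircase-++-isAscent tail-s)

    length-demote : length (demote t j) ≡ length t
    length-demote = trans (cong length demote≡) (trans length-s≡length-t (cong length (sym t≡)))

    demote-inS4 : inS4 (demote t j) ≡ true
    demote-inS4 = subst (λ xs → inS4 xs ≡ true) (sym demote≡) inS4-s

    ealm-demote : ealm (demote t j) ≡ j
    ealm-demote = trans (cong ealm demote≡) (staircase-++-ealm tail-s)

    promote-demote : promote (demote t j) ≡ t
    promote-demote = trans (cong promote demote≡) (trans promote-s (sym t≡))

  Dom-≡ : ∀ {n i} {d d′ : Dom n i} → proj₁ d ≡ proj₁ d′ → d ≡ d′
  Dom-≡ {d = _ , a , b , c , e} {d′ = _ , a′ , b′ , c′ , e′} refl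
    rewrite uip a a′ | uip b b′ | uip c c′ | uip e e′ = refl

  Cod-≡ : ∀ {n i} {d d′ : Cod n i} → proj₁ d ≡ proj₁ d′ → d ≡ d′
  Cod-≡ {d = _ , a , b , c , e , f} {d′ = _ , a′ , b′ , c′ , e′ , f′} refl
    rewrite uip a a′ | uip b b′ | uip c c′ | uip e e′ | uip f f′ = refl

  module _ {n i : ℕ} where

    ξ-to : Dom n i → Cod n i
    ξ-to (s , asc-s , len-s , s4 , ealm≡i) =
      (promote s , i) , promote-isAscent , trans length-promote len-s , promote-inP , refl ,
      subst (λ k → (k <ᵇ ealm (promote s)) ≡ true) ealm≡i ealm<ᵇealm-promote
      where open S4ViewProperties (s4View s asc-s s4)

    ξ-from : Cod n i → Dom n i
    ξ-from ((t , j) , asc-t , len-t , nonP , refl , j<ealm) =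
      demote t j , demote-isAscent , trans length-demote len-t , demote-inS4 , ealm-demote
      where open NonPViewProperties (nonPView t j asc-t nonP j<ealm)

    ξ-to∘ξ-from : ∀ d → ξ-to (ξ-from d) ≡ d
    ξ-to∘ξ-from ((t , j) , asc-t , len-t , nonP , refl , j<ealm) = Cod-≡ (cong (_, j) promote-demote)
      where open NonPViewProperties (nonPView t j asc-t nonP j<ealm)

    ξ-from∘ξ-to : ∀ d → ξ-from (ξ-to d) ≡ d
    ξ-from∘ξ-to (s , asc-s , len-s , s4 , ealm≡i) = Dom-≡ (trans (cong (demote (promote s)) (sym ealm≡i)) demote-promote)
      where open S4ViewProperties (s4View s asc-s s4)

    ξ : Dom n i ⤖ Cod n i
    ξ = ↔⇒⤖ (mk↔ₛ′ ξ-to ξ-from ξ-to∘ξ-from ξ-from∘ξ-to)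

    ξ-statistics : (d : Dom n i) →
      asc (proj₁ d) ≡ asc (proj₁ (proj₁ (ξ-to d)))
      × rep (proj₁ d) ≡ rep (proj₁ (proj₁ (ξ-to d)))
      × suc (maxS (proj₁ d)) ≡ maxS (proj₁ (proj₁ (ξ-to d)))
      × zeroS (proj₁ d) ≡ zeroS (proj₁ (proj₁ (ξ-to d))) + χ (i ≡ᵇ 0)
    ξ-statistics (s , asc-s , len-s , s4 , ealm≡i) =
      asc-promote , rep-promote , maxS-promote , subst (λ k → zeroS s ≡ zeroS (promote s) + χ (k ≡ᵇ 0)) ealm≡i zeroS-promote
      where open S4ViewProperties (s4View s asc-s s4)

  -- Deleting the fixed point max(s) - 1 of a sequence in 𝒫

  -- Both are only used on values x ≠ v.
  punchOut : ℕ → ℕ → ℕ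
  punchOut v x = if v <ᵇ x then x ∸ 1 else x

  punchIn : ℕ → ℕ → ℕ
  punchIn v x = if v ≤ᵇ x then suc x else x

  punchOut-below : ∀ {v x} → x ≤ v → punchOut v x ≡ x
  punchOut-below {v} {x} x≤v = cong (λ b → if b then x ∸ 1 else x) (≥⇒<ᵇ≡false x≤v)

  punchOut-above : ∀ {v y} → v ≤ y → punchOut v (suc y) ≡ y
  punchOut-above {v} {y} v≤y = cong (λ b → if b then y else suc y) (<⇒<ᵇ≡true (s≤s v≤y))

  punchIn-below : ∀ {v x} → x < v → punchIn v x ≡ x
  punchIn-below {v} {x} x<v = cong (λ b → if b then suc x else x) (>⇒≤ᵇ≡false x<v)

  punchIn-above : ∀ {v x} → v ≤ x → punchIn v x ≡ suc x
  punchIn-above {v} {x} v≤x = cong (λ b → if b then suc x else x) (≤⇒≤ᵇ≡true v≤x)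

  data PunchView (v x : ℕ) : Set where
    below : x < v → PunchView v x
    above : ∀ {y} → x ≡ suc y → v ≤ y → PunchView v x

  punchView : ∀ v x → x ≢ v → PunchView v x
  punchView v x x≢v with <-cmp x v
  ... | tri< x<v _ _ = below x<v
  ... | tri≈ _ x≡v _ = ⊥-elim (x≢v x≡v)
  punchView v (suc y) x≢v | tri> _ _ (s≤s v≤y) = above refl v≤y

  punchOut-punchIn : ∀ v x → punchOut v (punchIn v x) ≡ x
  punchOut-punchIn v x with <-cmp x v
  ... | tri< x<v _ _ = trans (cong (punchOut v) (punchIn-below x<v)) (punchOut-below (<⇒≤ x<v))
  ... | tri≈ _ refl _ = trans (cong (punchOut v) (punchIn-above ≤-refl)) (punchOut-above ≤-refl)
  ... | tri> _ _ v<x = trans (cong (punchOut v) (punchIn-above (<⇒≤ v<x))) (punchOut-above (<⇒≤ v<x))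

  punchIn-punchOut : ∀ {v x} → x ≢ v → punchIn v (punchOut v x) ≡ x
  punchIn-punchOut {v} {x} x≢v with punchView v x x≢v
  ... | below x<v        = trans (cong (punchIn v) (punchOut-below (<⇒≤ x<v))) (punchIn-below x<v)
  ... | above refl v≤y   = trans (cong (punchIn v) (punchOut-above v≤y)) (punchIn-above v≤y)

  punchIn≢ : ∀ v x → punchIn v x ≢ v
  punchIn≢ v x with <-cmp x v
  ... | tri< x<v _ _ = λ e → <-irrefl (trans (sym (punchIn-below x<v)) e) x<v
  ... | tri≈ _ refl _ = λ e → <-irrefl (sym (trans (sym (punchIn-above ≤-refl)) e)) ≤-refl
  ... | tri> _ _ v<x = λ e → <-asym v<x (≤-reflexive (trans (sym (punchIn-above (<⇒≤ v<x))) e))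

  punchIn-injective : ∀ {v x y} → punchIn v x ≡ punchIn v y → x ≡ y
  punchIn-injective {v} {x} {y} e = trans (sym (punchOut-punchIn v x)) (trans (cong (punchOut v) e) (punchOut-punchIn v y))

  bool-ext : ∀ {a b : Bool} → (a ≡ true → b ≡ true) → (b ≡ true → a ≡ true) → a ≡ b
  bool-ext {true}  {true}  _ _ = refl
  bool-ext {true}  {false} f _ = sym (f refl)
  bool-ext {false} {true}  _ g = g refl
  bool-ext {false} {false} _ _ = refl

  punchOut-<ᵇ : ∀ {v x y} → x ≢ v → y ≢ v → (x <ᵇ y) ≡ (punchOut v x <ᵇ punchOut v y)
  punchOut-<ᵇ {v} {x} {y} x≢v y≢v =
    bool-ext (λ h → <⇒<ᵇ≡true (to (<ᵇ≡true⇒< x y h))) (λ h → <⇒<ᵇ≡true (from (<ᵇ≡true⇒< _ _ h)))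
    where
    to : x < y → punchOut v x < punchOut v y
    to x<y with punchView v x x≢v | punchView v y y≢v
    ... | below x<v      | below y<v
      rewrite punchOut-below {v} (<⇒≤ x<v) | punchOut-below {v} (<⇒≤ y<v) = x<y
    ... | below x<v      | above refl v≤y′
      rewrite punchOut-below {v} (<⇒≤ x<v) | punchOut-above v≤y′ = ≤-trans x<v v≤y′
    ... | above refl v≤x′ | below y<v = ⊥-elim (<-asym x<y (≤-trans y<v (≤-trans v≤x′ (n≤1+n _))))
    ... | above refl v≤x′ | above refl v≤y′
      rewrite punchOut-above v≤x′ | punchOut-above v≤y′ = ≤-pred x<y
    from : punchOut v x < punchOut v y → x < y
    from lt with punchView v x x≢v | punchView v y y≢v
    ... | below x<v      | below y<v
      rewrite punchOut-below {v} (<⇒≤ x<v) | punchOut-below {v} (<⇒≤ y<v) = lt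
    ... | below x<v      | above refl v≤y′ = ≤-trans x<v (≤-trans v≤y′ (n≤1+n _))
    ... | above refl v≤x′ | below y<v
      rewrite punchOut-above v≤x′ | punchOut-below {v} (<⇒≤ y<v) = ⊥-elim (<-asym lt (≤-trans y<v v≤x′))
    ... | above refl v≤x′ | above refl v≤y′
      rewrite punchOut-above v≤x′ | punchOut-above v≤y′ = s≤s lt

  punchOut-≤ᵇ-suc : ∀ {v x a} → x ≢ v → v ≤ a → (x ≤ᵇ suc a) ≡ (punchOut v x ≤ᵇ a)
  punchOut-≤ᵇ-suc {v} {x} {a} x≢v v≤a =
    bool-ext (λ h → ≤⇒≤ᵇ≡true (to (≤ᵇ≡true⇒≤ x (suc a) h))) (λ h → ≤⇒≤ᵇ≡true (from (≤ᵇ≡true⇒≤ _ a h)))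
    where
    to : x ≤ suc a → punchOut v x ≤ a
    to x≤ with punchView v x x≢v
    ... | below x<v rewrite punchOut-below {v} (<⇒≤ x<v) = ≤-trans (<⇒≤ x<v) v≤a
    ... | above refl v≤y rewrite punchOut-above v≤y = ≤-pred x≤
    from : punchOut v x ≤ a → x ≤ suc a
    from ≤a with punchView v x x≢v
    ... | below x<v rewrite punchOut-below {v} (<⇒≤ x<v) = m≤n⇒m≤1+n ≤a
    ... | above refl v≤y rewrite punchOut-above v≤y = s≤s ≤a

  ascCondFrom-punchOut : ∀ v prev a xs → v ≤ suc a → prev ≢ v → All (_≢ v) xs →
    ascCondFrom prev (suc a) xs ≡ ascCondFrom (punchOut v prev) a (map (punchOut v) xs)
  ascCondFrom-punchOut v prev a []       _   _      _ = refl
  ascCondFrom-punchOut v prev a (x ∷ xs) v≤a prev≢v (x≢v ∷ xs≢v) =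
    cong₂ _∧_ (punchOut-≤ᵇ-suc x≢v v≤a)
      (trans (ascCondFrom-punchOut v x (a + indicator (prev <ᵇ x)) xs (≤-trans v≤a (m≤m+n (suc a) _)) x≢v xs≢v)
             (cong (λ b → ascCondFrom (punchOut v x) (a + indicator b) (map (punchOut v) xs)) (punchOut-<ᵇ prev≢v x≢v)))

  asc-punchOut : ∀ v xs → All (_≢ v) xs → asc (map (punchOut v) xs) ≡ asc xs
  asc-punchOut v []           _                 = refl
  asc-punchOut v (x ∷ [])     _                 = refl
  asc-punchOut v (x ∷ y ∷ ys) (x≢v ∷ y≢v ∷ ys≢v) =
    cong₂ _+_ (cong indicator (sym (punchOut-<ᵇ x≢v y≢v))) (asc-punchOut v (y ∷ ys) (y≢v ∷ ys≢v))

  count-zero-punchOut : ∀ v xs → 0 < v → count 0 (map (punchOut v) xs) ≡ count 0 xs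
  count-zero-punchOut v []       _   = refl
  count-zero-punchOut v (x ∷ xs) 0<v = cong₂ _+_ (cong indicator (is-zero x)) (count-zero-punchOut v xs 0<v)
    where
    is-zero : ∀ x → (punchOut v x ≡ᵇ 0) ≡ (x ≡ᵇ 0)
    is-zero x with <-cmp x v
    ... | tri< x<v _ _ rewrite punchOut-below {v} (<⇒≤ x<v) = refl
    ... | tri≈ _ refl _ rewrite punchOut-below {v} {v} ≤-refl = refl
    is-zero (suc y) | tri> _ _ (s≤s v≤y) rewrite punchOut-above v≤y = ≢⇒≡ᵇ≡false (>⇒≢ (≤-trans 0<v v≤y))

  map-punchOut-punchIn : ∀ v xs → map (punchOut v) (map (punchIn v) xs) ≡ xs
  map-punchOut-punchIn v []       = refl
  map-punchOut-punchIn v (x ∷ xs) = cong₂ _∷_ (punchOut-punchIn v x) (map-punchOut-punchIn v xs)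

  map-punchIn-punchOut : ∀ v xs → All (_≢ v) xs → map (punchIn v) (map (punchOut v) xs) ≡ xs
  map-punchIn-punchOut v []       _             = refl
  map-punchIn-punchOut v (x ∷ xs) (x≢v ∷ xs≢v) = cong₂ _∷_ (punchIn-punchOut x≢v) (map-punchIn-punchOut v xs xs≢v)

  All-punchIn≢ : ∀ v xs → All (_≢ v) (map (punchIn v) xs)
  All-punchIn≢ v []       = []
  All-punchIn≢ v (x ∷ xs) = punchIn≢ v x ∷ All-punchIn≢ v xs

  map-punchIn-upFrom : ∀ v k n → k + n ≤ v → map (punchIn v) (upFrom k n) ≡ upFrom k n
  map-punchIn-upFrom v k zero    _     = refl
  map-punchIn-upFrom v k (suc n) k+n<v = cong₂ _∷_ (punchIn-below (≤-trans (s≤s (m≤m+n k n)) k+n≤v′))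
                                                 (map-punchIn-upFrom v (suc k) n k+n≤v′)
    where
    k+n≤v′ : suc k + n ≤ v
    k+n≤v′ = ≤-trans (≤-reflexive (sym (+-suc k n))) k+n<v

  ∉⇒All≢ : ∀ {v : ℕ} xs → v ∉ xs → All (_≢ v) xs
  ∉⇒All≢ xs v∉ = All.map (λ v≢x x≡v → v≢x (sym x≡v)) (¬Any⇒All¬ xs v∉)

  deleteMax : List ℕ → List ℕ
  deleteMax s = staircase (maxS s ∸ 1) ++ map (punchOut (maxS s ∸ 1)) (drop (maxS s) s)

  insertMax : List ℕ → List ℕ
  insertMax t = staircase (suc (maxS t)) ++ map (punchIn (maxS t)) (drop (maxS t) t)

  -- s = 0 … (m+1) c r ∈ 𝒫, i.e. m + 1 does not occur in c ∷ r.
  PShape : ℕ → ℕ → List ℕ → Set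
  PShape m c r = c ≤ m × ascCondFrom c (suc m) r ≡ true × All (_≢ suc m) r

  pSeq : ℕ → ℕ → List ℕ → List ℕ
  pSeq m c r = staircase (2 + m) ++ c ∷ r

  deletedSeq : ℕ → ℕ → List ℕ → List ℕ
  deletedSeq m c r = staircase (suc m) ++ c ∷ map (punchOut (suc m)) r

  module PShapeProperties {m c : ℕ} {r : List ℕ} (shape : PShape m c r) where

    private
      v = suc m
      s = pSeq m c r
      t = deletedSeq m c r
      c≤m = proj₁ shape
      r≢v = proj₂ (proj₂ shape)

    c≢v : c ≢ v
    c≢v = <⇒≢ (s≤s c≤m)

    punchOut-c : punchOut v c ≡ c
    punchOut-c = punchOut-below (m≤n⇒m≤1+n c≤m)

    punchIn-c : punchIn v c ≡ c
    punchIn-c = punchIn-below (s≤s c≤m)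

    tail-s : Tail (suc m) c r
    tail-s = m≤n⇒m≤1+n c≤m , proj₁ (proj₂ shape)

    tail-t : Tail m c (map (punchOut v) r)
    tail-t = c≤m , trans (cong (λ x → ascCondFrom x m (map (punchOut v) r)) (sym punchOut-c))
                         (trans (sym (ascCondFrom-punchOut v c m r ≤-refl c≢v r≢v)) (proj₁ (proj₂ shape)))

    maxS-s : maxS s ≡ 2 + m
    maxS-s = staircase-++-maxS tail-s

    maxS-t : maxS t ≡ suc m
    maxS-t = staircase-++-maxS tail-t

    deleteMax-s : deleteMax s ≡ t
    deleteMax-s = trans (cong (λ p → staircase (p ∸ 1) ++ map (punchOut (p ∸ 1)) (drop p s)) maxS-s)
      (trans (cong (λ xs → staircase v ++ map (punchOut v) xs) (drop-upFrom-++ 0 (2 + m) (c ∷ r)))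
             (cong (λ x → staircase v ++ x ∷ map (punchOut v) r) punchOut-c))

    insertMax-t : insertMax t ≡ s
    insertMax-t = trans (cong (λ p → staircase (suc p) ++ map (punchIn p) (drop p t)) maxS-t)
      (trans (cong (λ xs → staircase (2 + m) ++ map (punchIn v) xs) (drop-upFrom-++ 0 v (c ∷ map (punchOut v) r)))
             (cong₂ (λ x xs → staircase (2 + m) ++ x ∷ xs) punchIn-c (map-punchIn-punchOut v r r≢v)))

    length-s≡1+length-t : length s ≡ suc (length t)
    length-s≡1+length-t = trans (staircase-++-length tail-s)
      (cong suc (sym (trans (staircase-++-length tail-t) (cong (λ k → suc m + suc k) (length-map (punchOut v) r)))))

    inP-s : inP s ≡ true
    inP-s = trans (staircase-++-inP tail-s) (cong (_≡ᵇ 0) (∉⇒count≡0 (c ∷ r) (All¬⇒¬Any (All.map (λ x≢v v≡x → x≢v (sym v≡x)) (c≢v ∷ r≢v)))))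

    ealm-s≡ealm-t : ealm s ≡ ealm t
    ealm-s≡ealm-t = trans (staircase-++-ealm tail-s) (sym (staircase-++-ealm tail-t))

    maxS-s≡1+maxS-t : maxS s ≡ suc (maxS t)
    maxS-s≡1+maxS-t = trans maxS-s (cong suc (sym maxS-t))

    asc-s≡1+asc-t : asc s ≡ suc (asc t)
    asc-s≡1+asc-t = begin
      asc s                                                          ≡⟨ asc-upFrom-++ 0 (suc m) c r ⟩
      suc m + (indicator (suc m <ᵇ c) + asc (c ∷ r))                 ≡⟨ cong (λ b → suc m + (indicator b + asc (c ∷ r))) (≥⇒<ᵇ≡false (m≤n⇒m≤1+n c≤m)) ⟩
      suc (m + asc (c ∷ r))                                          ≡⟨ cong (λ k → suc (m + k)) (asc-punchOut v (c ∷ r) (c≢v ∷ r≢v)) ⟨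
      suc (m + asc (punchOut v c ∷ map (punchOut v) r))              ≡⟨ cong (λ x → suc (m + asc (x ∷ map (punchOut v) r))) punchOut-c ⟩
      suc (m + asc (c ∷ map (punchOut v) r))                         ≡⟨ cong (λ b → suc (m + (indicator b + asc (c ∷ map (punchOut v) r)))) (≥⇒<ᵇ≡false c≤m) ⟨
      suc (m + (indicator (m <ᵇ c) + asc (c ∷ map (punchOut v) r)))  ≡⟨ cong suc (asc-upFrom-++ 0 m c (map (punchOut v) r)) ⟨
      suc (asc t)                                                    ∎
      where open ≡-Reasoning

    zeroS-s≡zeroS-t : zeroS s ≡ zeroS t
    zeroS-s≡zeroS-t = begin
      zeroS s                                                              ≡⟨ count-++ 0 (staircase (2 + m)) (c ∷ r) ⟩
      count 0 (staircase (2 + m)) + count 0 (c ∷ r)                        ≡⟨ cong (_+ count 0 (c ∷ r)) (count-zero-staircase (suc m)) ⟩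
      suc (count 0 (c ∷ r))                                                ≡⟨ cong suc (count-zero-punchOut v (c ∷ r) (s≤s z≤n)) ⟨
      suc (count 0 (punchOut v c ∷ map (punchOut v) r))                    ≡⟨ cong (λ x → suc (count 0 (x ∷ map (punchOut v) r))) punchOut-c ⟩
      suc (count 0 (c ∷ map (punchOut v) r))                               ≡⟨ cong (_+ count 0 (c ∷ map (punchOut v) r)) (count-zero-staircase m) ⟨
      count 0 (staircase (suc m)) + count 0 (c ∷ map (punchOut v) r)       ≡⟨ count-++ 0 (staircase (suc m)) (c ∷ map (punchOut v) r) ⟨
      zeroS t                                                              ∎
      where open ≡-Reasoning

    -- The values of s are v together with the values of t shifted up past v.
    rep-s≡rep-t : rep s ≡ rep t
    rep-s≡rep-t = cong₂ _∸_ length-s≡1+length-t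
      (trans (length-deduplicate-unique values! (mk⇔ values⊆s s⊆values))
             (cong suc (length-map (punchIn v) (deduplicate _≟_ t))))
      where
      punchIn-t : map (punchIn v) t ≡ staircase v ++ c ∷ r
      punchIn-t = trans (map-++ (punchIn v) (staircase v) (c ∷ map (punchOut v) r))
        (cong₂ _++_ (map-punchIn-upFrom v 0 v ≤-refl) (cong₂ _∷_ punchIn-c (map-punchIn-punchOut v r r≢v)))
      s≡ : s ≡ staircase v ++ v ∷ c ∷ r
      s≡ = upFrom-suc-++ 0 v (c ∷ r)
      values : List ℕ
      values = v ∷ map (punchIn v) (deduplicate _≟_ t)
      values! : Unique values
      values! = All.map (λ x≢v v≡x → x≢v (sym v≡x)) (All-punchIn≢ v (deduplicate _≟_ t))
                ∷ map⁺ punchIn-injective (deduplicate-! t)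
      t⊆dedup : ∀ {x} → x ∈ map (punchIn v) t → x ∈ map (punchIn v) (deduplicate _≟_ t)
      t⊆dedup x∈ with ∈-map⁻ (punchIn v) x∈
      ... | y , y∈t , refl = ∈-map⁺ (punchIn v) (Equivalence.to (deduplicate-∈⇔ _≟_) y∈t)
      values⊆s : ∀ {x} → x ∈ values → x ∈ s
      values⊆s (here refl) = subst (v ∈_) (sym s≡) (∈-++⁺ʳ (staircase v) (here refl))
      values⊆s (there x∈) with ∈-map⁻ (punchIn v) x∈
      ... | y , y∈ , refl with ∈-++⁻ (staircase v) (subst (punchIn v y ∈_) punchIn-t (∈-map⁺ (punchIn v) (Equivalence.from (deduplicate-∈⇔ _≟_) y∈)))
      ...   | inj₁ x∈staircase = subst (punchIn v y ∈_) (sym s≡) (∈-++⁺ˡ x∈staircase)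
      ...   | inj₂ x∈c∷r       = subst (punchIn v y ∈_) (sym s≡) (∈-++⁺ʳ (staircase v) (there x∈c∷r))
      s⊆values : ∀ {x} → x ∈ s → x ∈ values
      s⊆values {x} x∈ with ∈-++⁻ (staircase v) (subst (x ∈_) s≡ x∈)
      ... | inj₁ x∈staircase    = there (t⊆dedup (subst (x ∈_) (sym punchIn-t) (∈-++⁺ˡ x∈staircase)))
      ... | inj₂ (here refl)    = here refl
      ... | inj₂ (there x∈c∷r) = there (t⊆dedup (subst (x ∈_) (sym punchIn-t) (∈-++⁺ʳ (staircase v) x∈c∷r)))

  record PView (s : List ℕ) : Set where
    constructor p-view
    field
      {m c}  : ℕ
      {r}    : List ℕ
      shape  : PShape m c r
      s≡     : s ≡ pSeq m c r

  pView : ∀ s → isAscent s ≡ true → (maxS s <ᵇ length s) ≡ true → inP s ≡ true → PView s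
  pView s asc-s max<length inP-s with staircaseView s asc-s max<length
  ... | staircase-view {height = h} {entry = c} {rest = r} refl tail = build h refl
    where
    h∉c∷r : h ∉ c ∷ r
    h∉c∷r h∈ = <-irrefl (sym (≡ᵇ≡true⇒≡ _ 0 (trans (sym (staircase-++-inP tail)) inP-s))) (∈⇒count>0 h∈)
    build : ∀ m → m ≡ h → PView (staircase (suc h) ++ c ∷ r)
    build zero    refl with z≤n ← proj₁ tail = ⊥-elim (h∉c∷r (here refl))
    build (suc m) refl = p-view (c≤m , proj₂ tail , ∉⇒All≢ r (h∉c∷r ∘ there)) refl
      where
      c≤m : c ≤ m
      c≤m = ≤-pred (≤∧≢⇒< (proj₁ tail) (λ c≡h → h∉c∷r (here (sym c≡h))))

  -- Every t with max(t) < |t| is deleteMax of a sequence in 𝒫.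
  record DeletedView (t : List ℕ) : Set where
    constructor deleted-view
    field
      {m c}  : ℕ
      {r}    : List ℕ
      shape  : PShape m c (map (punchIn (suc m)) r)
      t≡     : t ≡ deletedSeq m c (map (punchIn (suc m)) r)

  deletedView : ∀ t → isAscent t ≡ true → (maxS t <ᵇ length t) ≡ true → DeletedView t
  deletedView t asc-t max<length with staircaseView t asc-t max<length
  ... | staircase-view {height = m} {entry = c} {rest = r} refl (c≤m , asc-r) =
    deleted-view (c≤m , asc-punchIn-r , All-punchIn≢ (suc m) r)
                 (cong (λ xs → staircase (suc m) ++ c ∷ xs) (sym (map-punchOut-punchIn (suc m) r)))
    where
    asc-punchIn-r : ascCondFrom c (suc m) (map (punchIn (suc m)) r) ≡ true
    asc-punchIn-r = trans (ascCondFrom-punchOut (suc m) c m (map (punchIn (suc m)) r) ≤-refl (<⇒≢ (s≤s c≤m)) (All-punchIn≢ (suc m) r))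
      (trans (cong₂ (λ x xs → ascCondFrom x m xs) (punchOut-below (m≤n⇒m≤1+n c≤m)) (map-punchOut-punchIn (suc m) r)) asc-r)

  -- Enumerations as duplicate-free lists

  dependentProductWith : {A B C : Set} → (A → B → C) → (A → List B) → List A → List C
  dependentProductWith g h = concatMap (λ a → map (g a) (h a))

  module _ {A B C : Set} (g : A → B → C) (h : A → List B) where

    ∈-dependentProductWith⁻ : ∀ {y} xs → y ∈ dependentProductWith g h xs →
      Σ A λ a → Σ B λ b → a ∈ xs × b ∈ h a × y ≡ g a b
    ∈-dependentProductWith⁻ (x ∷ xs) y∈ with ∈-++⁻ (map (g x) (h x)) y∈
    ... | inj₁ y∈gx with b , b∈ , refl ← ∈-map⁻ (g x) y∈gx = x , b , here refl , b∈ , refl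
    ... | inj₂ y∈rest with a , b , a∈ , b∈ , refl ← ∈-dependentProductWith⁻ xs y∈rest = a , b , there a∈ , b∈ , refl

    ∈-dependentProductWith⁺ : ∀ {a b} xs → a ∈ xs → b ∈ h a → g a b ∈ dependentProductWith g h xs
    ∈-dependentProductWith⁺ (x ∷ xs) (here refl) b∈ = ∈-++⁺ˡ (∈-map⁺ (g x) b∈)
    ∈-dependentProductWith⁺ (x ∷ xs) (there a∈) b∈ = ∈-++⁺ʳ (map (g x) (h x)) (∈-dependentProductWith⁺ xs a∈ b∈)

    dependentProductWith-unique : (∀ {a a′ b b′} → g a b ≡ g a′ b′ → a ≡ a′ × b ≡ b′) → (∀ a → Unique (h a)) →
      ∀ {xs} → Unique xs → Unique (dependentProductWith g h xs)
    dependentProductWith-unique g-injective h! {[]}     _          = []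
    dependentProductWith-unique g-injective h! {x ∷ xs} (x∉ ∷ xs!) =
      ++⁺ (map⁺ (proj₂ ∘ g-injective) (h! x)) (dependentProductWith-unique g-injective h! xs!) disjoint
      where
      disjoint : ∀ {y} → y ∈ map (g x) (h x) × y ∈ dependentProductWith g h xs → ⊥
      disjoint (y∈gx , y∈rest) with ∈-map⁻ (g x) y∈gx | ∈-dependentProductWith⁻ xs y∈rest
      ... | _ , _ , refl | _ , _ , a∈ , _ , g≡ = All.lookup x∉ a∈ (proj₁ (g-injective g≡))

  module _ {A : Set} (b : A → Bool) where

    ∈-filterᵇ⁻ : ∀ {x xs} → x ∈ filter (λ y → T? (b y)) xs → x ∈ xs × b x ≡ true
    ∈-filterᵇ⁻ x∈ with x∈xs , bx ← ∈-filter⁻ (λ y → T? (b y)) x∈ = x∈xs , Equivalence.to T-≡ bx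

    ∈-filterᵇ⁺ : ∀ {x xs} → x ∈ xs → b x ≡ true → x ∈ filter (λ y → T? (b y)) xs
    ∈-filterᵇ⁺ x∈ bx = ∈-filter⁺ (λ y → T? (b y)) x∈ (Equivalence.from T-≡ bx)

    filterᵇ-unique : ∀ {xs} → Unique xs → Unique (filter (λ y → T? (b y)) xs)
    filterᵇ-unique = filter⁺ (λ y → T? (b y))

  isInvFrom-++ : ∀ k xs ys → isInvFrom k xs ≡ true → isInvFrom (k + length xs) ys ≡ true → isInvFrom k (xs ++ ys) ≡ true
  isInvFrom-++ k []       ys _  h = subst (λ i → isInvFrom i ys ≡ true) (+-identityʳ k) h
  isInvFrom-++ k (x ∷ xs) ys h₁ h₂ =
    ∧-intro (∧-elimˡ h₁) (isInvFrom-++ (suc k) xs ys (∧-elimʳ h₁) (subst (λ i → isInvFrom i ys ≡ true) (+-suc k (length xs)) h₂))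

  isInvFrom-++⁻ : ∀ k xs ys → isInvFrom k (xs ++ ys) ≡ true → isInvFrom k xs ≡ true × isInvFrom (k + length xs) ys ≡ true
  isInvFrom-++⁻ k []       ys h = refl , subst (λ i → isInvFrom i ys ≡ true) (sym (+-identityʳ k)) h
  isInvFrom-++⁻ k (x ∷ xs) ys h with h₁ , h₂ ← isInvFrom-++⁻ (suc k) xs ys (∧-elimʳ {x ≤ᵇ k} h) =
    ∧-intro (∧-elimˡ h) h₁ , subst (λ i → isInvFrom i ys ≡ true) (sym (+-suc k (length xs))) h₂

  length-∷ʳ : ∀ (xs : List ℕ) v → length (xs ++ [ v ]) ≡ suc (length xs)
  length-∷ʳ xs v = trans (length-++ xs) (+-comm (length xs) 1)

  ∈-invSeqs⁻ : ∀ n {s} → s ∈ invSeqs n → isInv s ≡ true × length s ≡ n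
  ∈-invSeqs⁻ zero    (here refl) = refl , refl
  ∈-invSeqs⁻ (suc n) s∈
    with xs , v , xs∈ , v∈ , refl ← ∈-dependentProductWith⁻ _∷ʳ_ (λ _ → upTo (suc n)) (invSeqs n) s∈
    with inv-xs , len-xs ← ∈-invSeqs⁻ n xs∈ =
    isInvFrom-++ 0 xs [ v ] inv-xs (subst (λ i → isInvFrom i [ v ] ≡ true) (sym len-xs) (∧-intro (≤⇒≤ᵇ≡true (≤-pred (∈-upTo⁻ v∈))) refl)) ,
    trans (length-∷ʳ xs v) (cong suc len-xs)

  ∈-invSeqs⁺ : ∀ n {s} → isInv s ≡ true → length s ≡ n → s ∈ invSeqs n
  ∈-invSeqs⁺ n {s} = go n (reverseView s)
    where
    go : ∀ n {s} → Reverse s → isInv s ≡ true → length s ≡ n → s ∈ invSeqs n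
    go zero    []                   _     _     = here refl
    go (suc n) []                   _     ()
    go zero    (xs ∶ _ ∶ʳ v)        _     len-s with () ← trans (sym (length-∷ʳ xs v)) len-s
    go (suc n) (xs ∶ xs-view ∶ʳ v)  inv-s len-s =
      ∈-dependentProductWith⁺ _∷ʳ_ (λ _ → upTo (suc n)) (invSeqs n) (go n xs-view (proj₁ inv-parts) len-xs) (∈-upTo⁺ (s≤s v≤n))
      where
      inv-parts = isInvFrom-++⁻ 0 xs [ v ] inv-s
      len-xs : length xs ≡ n
      len-xs = suc-injective (trans (sym (length-∷ʳ xs v)) len-s)
      v≤n : v ≤ n
      v≤n = subst (v ≤_) len-xs (≤ᵇ≡true⇒≤ v (length xs) (∧-elimˡ (proj₂ inv-parts)))

  invSeqs-unique : ∀ n → Unique (invSeqs n)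
  invSeqs-unique zero    = [] ∷ []
  invSeqs-unique (suc n) =
    dependentProductWith-unique _∷ʳ_ (λ _ → upTo (suc n)) (∷ʳ-injective _ _) (λ _ → upTo⁺ (suc n)) (invSeqs-unique n)

  isAscent⇒isInv : ∀ s → isAscent s ≡ true → isInv s ≡ true
  isAscent⇒isInv []       _ = refl
  isAscent⇒isInv (x ∷ xs) h = ∧-elimˡ h

  ∈-ascSeqs⁻ : ∀ {n s} → s ∈ ascSeqs n → isAscent s ≡ true × length s ≡ n
  ∈-ascSeqs⁻ {n} s∈ with s∈invSeqs , asc-s ← ∈-filterᵇ⁻ isAscent s∈ = asc-s , proj₂ (∈-invSeqs⁻ n s∈invSeqs)

  ∈-ascSeqs⁺ : ∀ {n s} → isAscent s ≡ true → length s ≡ n → s ∈ ascSeqs n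
  ∈-ascSeqs⁺ {n} {s} asc-s len-s = ∈-filterᵇ⁺ isAscent (∈-invSeqs⁺ n (isAscent⇒isInv s asc-s) len-s) asc-s

  ascSeqs-unique : ∀ n → Unique (ascSeqs n)
  ascSeqs-unique n = filterᵇ-unique isAscent (invSeqs-unique n)

  module _ {A B : Set} (φ : A → B) (ψ : B → A) where

    map-unique-onLeftInverse : ∀ {xs} → (∀ {a} → a ∈ xs → ψ (φ a) ≡ a) → Unique xs → Unique (map φ xs)
    map-unique-onLeftInverse {[]}     _   _          = []
    map-unique-onLeftInverse {x ∷ xs} inv (x∉ ∷ xs!) =
      All.tabulate φx≢ ∷ map-unique-onLeftInverse (inv ∘ there) xs!
      where
      φx≢ : ∀ {y} → y ∈ map φ xs → φ x ≢ y
      φx≢ y∈ φx≡y with a , a∈ , refl ← ∈-map⁻ φ y∈ =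
        All.lookup x∉ a∈ (trans (sym (inv (here refl))) (trans (cong ψ φx≡y) (inv (there a∈))))

    map-↭-onInverse : ∀ {xs ys} → Unique xs → Unique ys →
      (∀ {a} → a ∈ xs → φ a ∈ ys) → (∀ {b} → b ∈ ys → ψ b ∈ xs) →
      (∀ {a} → a ∈ xs → ψ (φ a) ≡ a) → (∀ {b} → b ∈ ys → φ (ψ b) ≡ b) → map φ xs ↭ ys
    map-↭-onInverse {xs} {ys} xs! ys! φ∈ ψ∈ ψ∘φ φ∘ψ =
      ∼bag⇒↭ (unique∧set⇒bag (map-unique-onLeftInverse ψ∘φ xs!) ys! (mk⇔ to from))
      where
      to : ∀ {y} → y ∈ map φ xs → y ∈ ys
      to y∈ with a , a∈ , refl ← ∈-map⁻ φ y∈ = φ∈ a∈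
      from : ∀ {y} → y ∈ ys → y ∈ map φ xs
      from y∈ = subst (_∈ map φ xs) (φ∘ψ y∈) (∈-map⁺ φ (ψ∈ y∈))

  hasEalm : List ℕ → Bool
  hasEalm s = maxS s <ᵇ length s

  ealmSeqs : ℕ → List (List ℕ)
  ealmSeqs n = filter (λ s → T? (hasEalm s)) (ascSeqs n)

  ealmSeqsP : ℕ → List (List ℕ)
  ealmSeqsP n = filter (λ s → T? (inP s)) (ealmSeqs n)

  ealmSeqsNonP : ℕ → List (List ℕ)
  ealmSeqsNonP n = filter (λ s → T? (not (inP s))) (ealmSeqs n)

  s4Seqs : ℕ → List (List ℕ)
  s4Seqs n = filter (λ s → T? (inS4 s)) (ascSeqs n)

  nonPPairs : ℕ → List (List ℕ × ℕ)
  nonPPairs n = dependentProductWith _,_ (λ t → downFrom (ealm t)) (ealmSeqsNonP n)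

  ∈-ealmSeqs⁻ : ∀ n {s} → s ∈ ealmSeqs n → isAscent s ≡ true × length s ≡ n × hasEalm s ≡ true
  ∈-ealmSeqs⁻ n s∈ with s∈ascSeqs , has ← ∈-filterᵇ⁻ hasEalm {xs = ascSeqs n} s∈ =
    proj₁ (∈-ascSeqs⁻ {n} s∈ascSeqs) , proj₂ (∈-ascSeqs⁻ {n} s∈ascSeqs) , has

  ∈-ealmSeqs⁺ : ∀ n {s} → isAscent s ≡ true → length s ≡ n → hasEalm s ≡ true → s ∈ ealmSeqs n
  ∈-ealmSeqs⁺ n asc-s len-s has = ∈-filterᵇ⁺ hasEalm {xs = ascSeqs n} (∈-ascSeqs⁺ {n} asc-s len-s) has

  ealmSeqs-unique : ∀ n → Unique (ealmSeqs n)
  ealmSeqs-unique n = filterᵇ-unique hasEalm (ascSeqs-unique n)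

  nonPPairs-unique : ∀ n → Unique (nonPPairs n)
  nonPPairs-unique n = dependentProductWith-unique _,_ (λ t → downFrom (ealm t))
    (λ { refl → refl , refl }) (λ t → downFrom⁺ (ealm t)) (filterᵇ-unique (not ∘ inP) (ealmSeqs-unique n))

  module _ (n : ℕ) where

    private
      pView∈ : ∀ {s} → s ∈ ealmSeqsP (suc n) → PView s
      pView∈ {s} s∈ with s∈ealmSeqs , inP-s ← ∈-filterᵇ⁻ inP {xs = ealmSeqs (suc n)} s∈
                    with asc-s , _ , has ← ∈-ealmSeqs⁻ (suc n) s∈ealmSeqs = pView s asc-s has inP-s

      deletedView∈ : ∀ {t} → t ∈ ealmSeqs n → DeletedView t
      deletedView∈ {t} t∈ with asc-t , _ , has ← ∈-ealmSeqs⁻ n t∈ = deletedView t asc-t has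

    deleteMax-∈ : ∀ {s} → s ∈ ealmSeqsP (suc n) → deleteMax s ∈ ealmSeqs n
    deleteMax-∈ s∈ with pView∈ s∈
    ... | p-view shape refl =
      subst (_∈ ealmSeqs n) (sym deleteMax-s)
            (∈-ealmSeqs⁺ n (staircase-++-isAscent tail-t) (suc-injective (trans (sym length-s≡1+length-t) len-s))
                         (staircase-++-maxS<ᵇlength tail-t))
      where
      open PShapeProperties shape
      len-s = proj₁ (proj₂ (∈-ealmSeqs⁻ (suc n) (proj₁ (∈-filterᵇ⁻ inP {xs = ealmSeqs (suc n)} s∈))))

    insertMax-∈ : ∀ {t} → t ∈ ealmSeqs n → insertMax t ∈ ealmSeqsP (suc n)
    insertMax-∈ t∈ with deletedView∈ t∈
    ... | deleted-view shape refl =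
      subst (_∈ ealmSeqsP (suc n)) (sym insertMax-t)
            (∈-filterᵇ⁺ inP {xs = ealmSeqs (suc n)}
              (∈-ealmSeqs⁺ (suc n) (staircase-++-isAscent tail-s) (trans length-s≡1+length-t (cong suc len-t))
                           (staircase-++-maxS<ᵇlength tail-s))
              inP-s)
      where
      open PShapeProperties shape
      len-t = proj₁ (proj₂ (∈-ealmSeqs⁻ n t∈))

    insertMax-deleteMax : ∀ {s} → s ∈ ealmSeqsP (suc n) → insertMax (deleteMax s) ≡ s
    insertMax-deleteMax s∈ with pView∈ s∈
    ... | p-view shape refl = trans (cong insertMax deleteMax-s) insertMax-t
      where open PShapeProperties shape

    deleteMax-insertMax : ∀ {t} → t ∈ ealmSeqs n → deleteMax (insertMax t) ≡ t
    deleteMax-insertMax t∈ with deletedView∈ t∈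
    ... | deleted-view shape refl = trans (cong deleteMax insertMax-t) deleteMax-s
      where open PShapeProperties shape

    deleteMax-↭ : map deleteMax (ealmSeqsP (suc n)) ↭ ealmSeqs n
    deleteMax-↭ = map-↭-onInverse deleteMax insertMax
      (filterᵇ-unique inP (ealmSeqs-unique (suc n))) (ealmSeqs-unique n)
      deleteMax-∈ insertMax-∈ insertMax-deleteMax deleteMax-insertMax

    record DeleteMaxStatistics (s : List ℕ) : Set where
      field
        rep-deleteMax   : rep s ≡ rep (deleteMax s)
        maxS-deleteMax  : maxS s ≡ suc (maxS (deleteMax s))
        ealm-deleteMax  : ealm s ≡ ealm (deleteMax s)
        asc-deleteMax   : asc s ≡ suc (asc (deleteMax s))
        zeroS-deleteMax : zeroS s ≡ zeroS (deleteMax s)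

    deleteMax-statistics : ∀ {s} → s ∈ ealmSeqsP (suc n) → DeleteMaxStatistics s
    deleteMax-statistics s∈ with pView∈ s∈
    ... | p-view shape refl = record
      { rep-deleteMax   = trans rep-s≡rep-t (cong rep (sym deleteMax-s))
      ; maxS-deleteMax  = trans maxS-s≡1+maxS-t (cong (suc ∘ maxS) (sym deleteMax-s))
      ; ealm-deleteMax  = trans ealm-s≡ealm-t (cong ealm (sym deleteMax-s))
      ; asc-deleteMax   = trans asc-s≡1+asc-t (cong (suc ∘ asc) (sym deleteMax-s))
      ; zeroS-deleteMax = trans zeroS-s≡zeroS-t (cong zeroS (sym deleteMax-s))
      }
      where open PShapeProperties shape

    private
      nonPPair⇒ : ∀ {t j} → (t , j) ∈ nonPPairs n → t ∈ ealmSeqsNonP n × j < ealm t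
      nonPPair⇒ p∈ with _ , _ , t∈ , j∈ , refl ← ∈-dependentProductWith⁻ _,_ (λ t → downFrom (ealm t)) (ealmSeqsNonP n) p∈ =
        t∈ , ∈-downFrom⁻ j∈

      nonPView∈ : ∀ {t j} → (t , j) ∈ nonPPairs n → NonPView t j
      nonPView∈ {t} {j} p∈ with t∈ , j<ealm ← nonPPair⇒ p∈
                           with t∈ealmSeqs , nonP ← ∈-filterᵇ⁻ (not ∘ inP) {xs = ealmSeqs n} t∈ =
        nonPView t j (proj₁ (∈-ealmSeqs⁻ n t∈ealmSeqs)) (Equivalence.to T-not-≡ (Equivalence.from T-≡ nonP)) (<⇒<ᵇ≡true j<ealm)

      s4View∈ : ∀ {s} → s ∈ s4Seqs n → S4View s
      s4View∈ {s} s∈ with s∈ascSeqs , s4 ← ∈-filterᵇ⁻ inS4 {xs = ascSeqs n} s∈ = s4View s (proj₁ (∈-ascSeqs⁻ {n} s∈ascSeqs)) s4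

    demote-∈ : ∀ {p} → p ∈ nonPPairs n → uncurry demote p ∈ s4Seqs n
    demote-∈ {t , j} p∈ =
      ∈-filterᵇ⁺ inS4 {xs = ascSeqs n} (∈-ascSeqs⁺ {n} demote-isAscent (trans length-demote len-t)) demote-inS4
      where
      open NonPViewProperties (nonPView∈ p∈)
      len-t = proj₁ (proj₂ (∈-ealmSeqs⁻ n (proj₁ (∈-filterᵇ⁻ (not ∘ inP) {xs = ealmSeqs n} (proj₁ (nonPPair⇒ p∈))))))

    promote-∈ : ∀ {s} → s ∈ s4Seqs n → (promote s , ealm s) ∈ nonPPairs n
    promote-∈ {s} s∈ =
      ∈-dependentProductWith⁺ _,_ (λ t → downFrom (ealm t)) (ealmSeqsNonP n) promote∈
        (∈-downFrom⁺ (<ᵇ≡true⇒< _ _ ealm<ᵇealm-promote))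
      where
      open S4ViewProperties (s4View∈ s∈)
      open S4View (s4View∈ s∈) using (shape)
      open S4ShapeProperties shape using (tail-t)
      len-s = proj₂ (∈-ascSeqs⁻ {n} (proj₁ (∈-filterᵇ⁻ inS4 {xs = ascSeqs n} s∈)))
      promote∈ : promote s ∈ ealmSeqsNonP n
      promote∈ = ∈-filterᵇ⁺ (not ∘ inP) {xs = ealmSeqs n}
        (∈-ealmSeqs⁺ n promote-isAscent (trans length-promote len-s)
                     (subst (λ xs → hasEalm xs ≡ true) (sym promote≡) (staircase-++-maxS<ᵇlength tail-t)))
        (Equivalence.to T-≡ (Equivalence.from T-not-≡ promote-inP))

    demote-↭ : map (uncurry demote) (nonPPairs n) ↭ s4Seqs n
    demote-↭ = map-↭-onInverse (uncurry demote) (λ s → promote s , ealm s)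
      (nonPPairs-unique n) (filterᵇ-unique inS4 (ascSeqs-unique n)) demote-∈ promote-∈
      (λ { {t , j} p∈ → let open NonPViewProperties (nonPView∈ p∈) in cong₂ _,_ promote-demote ealm-demote })
      (λ s∈ → S4ViewProperties.demote-promote (s4View∈ s∈))

    -- Read off from part (i), applied to the sequence demote t j ∈ 𝒮₄.
    record DemoteStatistics (t : List ℕ) (j : ℕ) : Set where
      field
        rep-demote   : rep (demote t j) ≡ rep t
        maxS-demote  : suc (maxS (demote t j)) ≡ maxS t
        ealm-demote  : ealm (demote t j) ≡ j
        asc-demote   : asc (demote t j) ≡ asc t
        zeroS-demote : zeroS (demote t j) ≡ zeroS t + χ (j ≡ᵇ 0)

    demote-statistics : ∀ {t j} → (t , j) ∈ nonPPairs n → DemoteStatistics t j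
    demote-statistics {t} {j} p∈ = record
      { rep-demote   = trans rep-promote (cong rep promote-demote)
      ; maxS-demote  = trans maxS-promote (cong maxS promote-demote)
      ; ealm-demote  = ealm-demote
      ; asc-demote   = trans asc-promote (cong asc promote-demote)
      ; zeroS-demote = trans zeroS-promote (cong₂ (λ xs k → zeroS xs + χ (k ≡ᵇ 0)) promote-demote ealm-demote)
      }
      where
      open NonPViewProperties (nonPView∈ p∈)
      open S4ViewProperties (s4View (demote t j) demote-isAscent demote-inS4)

module Weights {c ℓ : Level} (R : CommutativeRing c ℓ) where

  open import Data.Bool using (Bool; true; false; T?; not)
  open import Data.Nat as ℕ using (ℕ; zero; suc; _≡ᵇ_)
  open import Data.List using (List; []; _∷_; map; filter; downFrom; _++_)
  open import Data.List.Membership.Propositional using (_∈_)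
  open import Data.List.Relation.Unary.Any using (here; there)
  open import Data.List.Relation.Binary.Permutation.Propositional using (_↭_; ↭⇒↭ₛ′)
  open import Data.List.Relation.Binary.Permutation.Propositional.Properties using () renaming (map⁺ to ↭-map⁺)
  open import Data.Product using (_,_; proj₁; proj₂; uncurry)
  open import Function.Base using (_∘_)
  import Relation.Binary.PropositionalEquality as ≡
  open import Algebra.Properties.Ring using (-1*x≈-x)

  open Sequences
  open CommutativeRing R
  open GF R
  open import Relation.Binary.Reasoning.Setoid setoid
  open import Data.List.Relation.Binary.Permutation.Setoid.Properties setoid using (foldr-commMonoid)
  open import Algebra.Solver.Ring.NaturalCoefficients.Default commutativeSemiring
  open import Algebra.Properties.AbelianGroup +-abelianGroup using (xyx⁻¹≈y)

  module _ {A : Set} where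

    sumL-cong-∈ : ∀ (f g : A → Carrier) xs → (∀ {a} → a ∈ xs → f a ≈ g a) → sumL (map f xs) ≈ sumL (map g xs)
    sumL-cong-∈ f g []       _   = refl
    sumL-cong-∈ f g (x ∷ xs) f≈g = +-cong (f≈g (here ≡.refl)) (sumL-cong-∈ f g xs (f≈g ∘ there))

    sumL-↭ : ∀ (f : A → Carrier) {xs ys} → xs ↭ ys → sumL (map f xs) ≈ sumL (map f ys)
    sumL-↭ f xs↭ys = foldr-commMonoid +-isCommutativeMonoid (↭⇒↭ₛ′ isEquivalence (↭-map⁺ f xs↭ys))

    sumL-++ : ∀ (f : A → Carrier) xs ys → sumL (map f (xs ++ ys)) ≈ sumL (map f xs) + sumL (map f ys)
    sumL-++ f []       ys = sym (+-identityˡ _)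
    sumL-++ f (x ∷ xs) ys = trans (+-cong refl (sumL-++ f xs ys)) (sym (+-assoc _ _ _))

    sumL-*ˡ : ∀ (k : Carrier) (f : A → Carrier) xs → sumL (map (λ a → k * f a) xs) ≈ k * sumL (map f xs)
    sumL-*ˡ k f []       = sym (zeroʳ k)
    sumL-*ˡ k f (x ∷ xs) = trans (+-cong refl (sumL-*ˡ k f xs)) (sym (distribˡ k _ _))

    sumL-+ : ∀ (f g : A → Carrier) xs → sumL (map (λ a → f a + g a) xs) ≈ sumL (map f xs) + sumL (map g xs)
    sumL-+ f g []       = sym (+-identityˡ 0#)
    sumL-+ f g (x ∷ xs) = trans (+-cong refl (sumL-+ f g xs))
      (solve 4 (λ a b c d → (a :+ b) :+ (c :+ d) := (a :+ c) :+ (b :+ d)) refl (f x) (g x) (sumL (map f xs)) (sumL (map g xs)))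

    sumL-partition : ∀ (b : A → Bool) (f : A → Carrier) xs →
      sumL (map f xs) ≈ sumL (map f (filter (λ a → T? (b a)) xs)) + sumL (map f (filter (λ a → T? (not (b a))) xs))
    sumL-partition b f []       = sym (+-identityˡ 0#)
    sumL-partition b f (x ∷ xs) with b x
    ... | true  = trans (+-cong refl (sumL-partition b f xs)) (sym (+-assoc _ _ _))
    ... | false = trans (+-cong refl (sumL-partition b f xs))
      (solve 3 (λ a c d → a :+ (c :+ d) := c :+ (a :+ d)) refl (f x) _ _)

    sumL-map : ∀ {B : Set} (f : B → Carrier) (φ : A → B) xs → sumL (map f (map φ xs)) ≡.≡ sumL (map (f ∘ φ) xs)
    sumL-map f φ []       = ≡.refl
    sumL-map f φ (x ∷ xs) = ≡.cong (f (φ x) +_) (sumL-map f φ xs)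

  sumL-dependentProductWith : ∀ {A B C : Set} (g : A → B → C) (h : A → List B) (f : C → Carrier) xs →
    sumL (map f (dependentProductWith g h xs)) ≈ sumL (map (λ a → sumL (map (f ∘ g a) (h a))) xs)
  sumL-dependentProductWith g h f []       = refl
  sumL-dependentProductWith g h f (x ∷ xs) = begin
    sumL (map f (map (g x) (h x) ++ dependentProductWith g h xs))
      ≈⟨ sumL-++ f (map (g x) (h x)) (dependentProductWith g h xs) ⟩
    sumL (map f (map (g x) (h x))) + sumL (map f (dependentProductWith g h xs))
      ≈⟨ +-cong (reflexive (sumL-map f (g x) (h x))) (sumL-dependentProductWith g h f xs) ⟩
    sumL (map (f ∘ g x) (h x)) + sumL (map (λ a → sumL (map (f ∘ g a) (h a))) xs) ∎

  -- The solver works over commutative semirings: −1 enters as the atom m, eliminated afterwards by 1 + m ≈ 0.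
  m : Carrier
  m = - 1#

  -x≈m*x : ∀ a → - a ≈ m * a
  -x≈m*x a = sym (-1*x≈-x ring a)

  x-y≈x+m*y : ∀ a b → a - b ≈ a + m * b
  x-y≈x+m*y a b = +-cong refl (-x≈m*x b)

  x+[1+m]*y≈x : ∀ a b → a + (1# + m) * b ≈ a
  x+[1+m]*y≈x a b = begin
    a + (1# + m) * b ≈⟨ +-cong refl (*-cong (-‿inverseʳ 1#) refl) ⟩
    a + 0# * b       ≈⟨ +-cong refl (zeroˡ b) ⟩
    a + 0#           ≈⟨ +-identityʳ a ⟩
    a                ∎

  ≈-modulo-1+m : ∀ {a b} d e → a + (1# + m) * d ≈ b + (1# + m) * e → a ≈ b
  ≈-modulo-1+m {a} {b} d e h = trans (sym (x+[1+m]*y≈x a d)) (trans h (x+[1+m]*y≈x b e))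

  x≈y+z⇒x-y≈z : ∀ {a b d} → a ≈ b + d → a - b ≈ d
  x≈y+z⇒x-y≈z {a} {b} {d} h = trans (+-cong h refl) (xyx⁻¹≈y b d)

  pow-+ : ∀ a i j → pow a (i ℕ.+ j) ≈ pow a i * pow a j
  pow-+ a zero    j = sym (*-identityˡ _)
  pow-+ a (suc i) j = trans (*-cong refl (pow-+ a i j)) (sym (*-assoc _ _ _))

  cong₅ : ∀ {A : Set c} (f : ℕ → ℕ → ℕ → ℕ → ℕ → A) {a a′ b b′ d d′ e e′ g g′} →
    a ≡.≡ a′ → b ≡.≡ b′ → d ≡.≡ d′ → e ≡.≡ e′ → g ≡.≡ g′ → f a b d e g ≡.≡ f a′ b′ d′ e′ g′
  cong₅ f ≡.refl ≡.refl ≡.refl ≡.refl ≡.refl = ≡.refl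

  module _ (x q w u z : Carrier) where

    weightWithoutEalm : List ℕ → Carrier
    weightWithoutEalm s = pow x (rep s) * pow q (maxS s) * pow u (asc s) * pow z (zeroS s)

    private
      weightOf : Carrier → ℕ → ℕ → ℕ → ℕ → ℕ → Carrier
      weightOf a k p e d n₀ = pow x k * pow q p * pow a e * pow u d * pow z n₀

    wt≈weightWithoutEalm* : ∀ a s → wt x q a u z s ≈ weightWithoutEalm s * pow a (ealm s)
    wt≈weightWithoutEalm* a s = solve 5 (λ X Q C U Z → X :* Q :* C :* U :* Z := X :* Q :* U :* Z :* C) refl
      (pow x (rep s)) (pow q (maxS s)) (pow a (ealm s)) (pow u (asc s)) (pow z (zeroS s))

    wt-deleteMax : ∀ a n {s} → s ∈ ealmSeqsP (suc n) → wt x q a u z s ≈ q * u * wt x q a u z (deleteMax s)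
    wt-deleteMax a n {s} s∈ = begin
      wt x q a u z s
        ≡⟨ cong₅ (weightOf a) rep-deleteMax maxS-deleteMax ealm-deleteMax asc-deleteMax zeroS-deleteMax ⟩
      weightOf a (rep s′) (suc (maxS s′)) (ealm s′) (suc (asc s′)) (zeroS s′)
        ≈⟨ solve 7 (λ X Q C U Z q′ u′ → X :* (q′ :* Q) :* C :* (u′ :* U) :* Z := q′ :* u′ :* (X :* Q :* C :* U :* Z)) refl
             (pow x (rep s′)) (pow q (maxS s′)) (pow a (ealm s′)) (pow u (asc s′)) (pow z (zeroS s′)) q u ⟩
      q * u * wt x q a u z s′ ∎
      where
      s′ = deleteMax s
      open DeleteMaxStatistics (deleteMax-statistics n s∈)

    -- The part of F coming from 𝒫 is qut·F: deleteMax is a bijection onto the sequences one shorter.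
    sumL-ealmSeqsP : ∀ a n → sumL (map (wt x q a u z) (ealmSeqsP n)) ≈ q * u * shift (Fc x q a u z) n
    sumL-ealmSeqsP a zero    = sym (zeroʳ _)
    sumL-ealmSeqsP a (suc n) = begin
      sumL (map (wt x q a u z) (ealmSeqsP (suc n)))                    ≈⟨ sumL-cong-∈ _ _ (ealmSeqsP (suc n)) (wt-deleteMax a n) ⟩
      sumL (map (λ s → q * u * wt x q a u z (deleteMax s)) (ealmSeqsP (suc n)))
                                                                       ≡⟨ sumL-map (λ s → q * u * wt x q a u z s) deleteMax (ealmSeqsP (suc n)) ⟨
      sumL (map (λ s → q * u * wt x q a u z s) (map deleteMax (ealmSeqsP (suc n))))
                                                                       ≈⟨ sumL-↭ (λ s → q * u * wt x q a u z s) (deleteMax-↭ n) ⟩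
      sumL (map (λ s → q * u * wt x q a u z s) (ealmSeqs n))           ≈⟨ sumL-*ˡ (q * u) (wt x q a u z) (ealmSeqs n) ⟩
      q * u * Fc x q a u z n                                           ∎

    oneMinusQUt-Fc : ∀ a n →
      oneMinusQUt q u (Fc x q a u z) n ≈ sumL (map (λ t → weightWithoutEalm t * pow a (ealm t)) (ealmSeqsNonP n))
    oneMinusQUt-Fc a n = trans (x≈y+z⇒x-y≈z (begin
      Fc x q a u z n                                                                     ≈⟨ sumL-partition inP (wt x q a u z) (ealmSeqs n) ⟩
      sumL (map (wt x q a u z) (ealmSeqsP n)) + sumL (map (wt x q a u z) (ealmSeqsNonP n)) ≈⟨ +-cong (sumL-ealmSeqsP a n) refl ⟩
      q * u * shift (Fc x q a u z) n + sumL (map (wt x q a u z) (ealmSeqsNonP n))          ∎))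
      (sumL-cong-∈ _ _ (ealmSeqsNonP n) (λ {t} _ → wt≈weightWithoutEalm* a t))

    -- Contribution of the pair (t, j): the factor w^j z^[j=0] records ealm and the extra zero of demote t j.
    pairWeight : ℕ → Carrier
    pairWeight j = pow w j * pow z (χ (j ≡ᵇ 0))

    pairWeightSum : ℕ → Carrier
    pairWeightSum e = sumL (map pairWeight (downFrom e))

    q*wt-demote : ∀ n {t j} → (t , j) ∈ nonPPairs n → q * wt x q w u z (demote t j) ≈ weightWithoutEalm t * pairWeight j
    q*wt-demote n {t} {j} p∈ = begin
      q * wt x q w u z s
        ≡⟨ ≡.cong (q *_) (cong₅ (weightOf w) rep-demote (≡.refl {x = maxS s}) ealm-demote asc-demote zeroS-demote) ⟩
      q * weightOf w (rep t) (maxS s) j (asc t) (zeroS t ℕ.+ χ (j ≡ᵇ 0))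
        ≈⟨ *-cong refl (*-cong refl (pow-+ z (zeroS t) (χ (j ≡ᵇ 0)))) ⟩
      q * (pow x (rep t) * pow q (maxS s) * pow w j * pow u (asc t) * (pow z (zeroS t) * pow z (χ (j ≡ᵇ 0))))
        ≈⟨ solve 7 (λ q′ X Q W U Z Z′ → q′ :* (X :* Q :* W :* U :* (Z :* Z′)) := (X :* (q′ :* Q) :* U :* Z) :* (W :* Z′)) refl
             q (pow x (rep t)) (pow q (maxS s)) (pow w j) (pow u (asc t)) (pow z (zeroS t)) (pow z (χ (j ≡ᵇ 0))) ⟩
      (pow x (rep t) * pow q (suc (maxS s)) * pow u (asc t) * pow z (zeroS t)) * pairWeight j
        ≡⟨ ≡.cong (λ k → (pow x (rep t) * pow q k * pow u (asc t) * pow z (zeroS t)) * pairWeight j) maxS-demote ⟩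
      weightWithoutEalm t * pairWeight j ∎
      where
      s = demote t j
      open DemoteStatistics (demote-statistics n p∈)

    q*S4c : ∀ n → q * S4c x q w u z n ≈ sumL (map (λ t → weightWithoutEalm t * pairWeightSum (ealm t)) (ealmSeqsNonP n))
    q*S4c n = begin
      q * S4c x q w u z n                                 ≈⟨ sumL-*ˡ q (wt x q w u z) (s4Seqs n) ⟨
      sumL (map f (s4Seqs n))                             ≈⟨ sumL-↭ f (demote-↭ n) ⟨
      sumL (map f (map (uncurry demote) (nonPPairs n)))   ≡⟨ sumL-map f (uncurry demote) (nonPPairs n) ⟩
      sumL (map (f ∘ uncurry demote) (nonPPairs n))       ≈⟨ sumL-cong-∈ _ _ (nonPPairs n) (λ { {t , j} → q*wt-demote n }) ⟩
      sumL (map (λ p → weightWithoutEalm (proj₁ p) * pairWeight (proj₂ p)) (nonPPairs n))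
        ≈⟨ sumL-dependentProductWith _,_ (λ t → downFrom (ealm t)) (λ p → weightWithoutEalm (proj₁ p) * pairWeight (proj₂ p)) (ealmSeqsNonP n) ⟩
      sumL (map (λ t → sumL (map (λ j → weightWithoutEalm t * pairWeight j) (downFrom (ealm t)))) (ealmSeqsNonP n))
        ≈⟨ sumL-cong-∈ _ _ (ealmSeqsNonP n) (λ {t} _ → sumL-*ˡ (weightWithoutEalm t) pairWeight (downFrom (ealm t))) ⟩
      sumL (map (λ t → weightWithoutEalm t * pairWeightSum (ealm t)) (ealmSeqsNonP n)) ∎
      where
      f = λ s → q * wt x q w u z s

    K : Carrier
    K = w + z + m * (w * z)

    M : Carrier
    M = m * ((z + m * 1#) * (1# + m * w))

    -- (1 - w)(z + w + … + w^{e-1}) = (w + z - wz) - w^e for e ≥ 1; the term with 0^e corrects e = 0.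
    pairWeightSum-geometric : ∀ e → (1# + m * w) * pairWeightSum e ≈ K * pow 1# e + m * pow w e + M * pow 0# e
    pairWeightSum-geometric zero = ≈-modulo-1+m (m * m * w + m * (w * z + 1#) + z + w) (m * w)
      (solve 3 (λ m′ w′ z′ → (con 1 :+ m′ :* w′) :* con 0 :+ (con 1 :+ m′) :* (m′ :* m′ :* w′ :+ m′ :* (w′ :* z′ :+ con 1) :+ z′ :+ w′)
                     := (w′ :+ z′ :+ m′ :* (w′ :* z′)) :* con 1 :+ m′ :* con 1 :+ m′ :* ((z′ :+ m′ :* con 1) :* (con 1 :+ m′ :* w′)) :* con 1
                        :+ (con 1 :+ m′) :* (m′ :* w′)) refl m w z)
    pairWeightSum-geometric (suc zero) = ≈-modulo-1+m w 0#
      (solve 3 (λ m′ w′ z′ → (con 1 :+ m′ :* w′) :* (con 1 :* (z′ :* con 1) :+ con 0) :+ (con 1 :+ m′) :* w′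
                     := (w′ :+ z′ :+ m′ :* (w′ :* z′)) :* (con 1 :* con 1) :+ m′ :* (w′ :* con 1)
                        :+ m′ :* ((z′ :+ m′ :* con 1) :* (con 1 :+ m′ :* w′)) :* (con 0 :* con 1) :+ (con 1 :+ m′) :* con 0) refl m w z)
    pairWeightSum-geometric (suc (suc k)) = trans (sym (begin
      K * pow 1# (2 ℕ.+ k) + m * pow w (2 ℕ.+ k) + M * pow 0# (2 ℕ.+ k) + (1# + m) * (w * pow w k)
        ≈⟨ solve 6 (λ m′ w′ z′ W P₁ P₀ →
             (w′ :+ z′ :+ m′ :* (w′ :* z′)) :* (con 1 :* (con 1 :* P₁)) :+ m′ :* (w′ :* (w′ :* W))
               :+ m′ :* ((z′ :+ m′ :* con 1) :* (con 1 :+ m′ :* w′)) :* (con 0 :* (con 0 :* P₀)) :+ (con 1 :+ m′) :* (w′ :* W)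
             := (con 1 :+ m′ :* w′) :* ((w′ :* W) :* con 1) :+ ((w′ :+ z′ :+ m′ :* (w′ :* z′)) :* (con 1 :* P₁) :+ m′ :* (w′ :* W)
               :+ m′ :* ((z′ :+ m′ :* con 1) :* (con 1 :+ m′ :* w′)) :* (con 0 :* P₀))) refl
             m w z (pow w k) (pow 1# k) (pow 0# k) ⟩
      (1# + m * w) * ((w * pow w k) * 1#) + (K * pow 1# (suc k) + m * pow w (suc k) + M * pow 0# (suc k))
        ≈⟨ +-cong refl (pairWeightSum-geometric (suc k)) ⟨
      (1# + m * w) * ((w * pow w k) * 1#) + (1# + m * w) * pairWeightSum (suc k)
        ≈⟨ distribˡ _ _ _ ⟨
      (1# + m * w) * pairWeightSum (2 ℕ.+ k) ∎)) (x+[1+m]*y≈x _ (w * pow w k))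

    private
      sumL-linear₃ : ∀ (f g h : List ℕ → Carrier) ts →
        sumL (map (λ t → K * f t + m * g t + M * h t) ts) ≈ K * sumL (map f ts) + m * sumL (map g ts) + M * sumL (map h ts)
      sumL-linear₃ f g h ts = begin
        sumL (map (λ t → K * f t + m * g t + M * h t) ts)
          ≈⟨ sumL-+ (λ t → K * f t + m * g t) (λ t → M * h t) ts ⟩
        sumL (map (λ t → K * f t + m * g t) ts) + sumL (map (λ t → M * h t) ts)
          ≈⟨ +-cong (sumL-+ (λ t → K * f t) (λ t → m * g t) ts) (sumL-*ˡ M h ts) ⟩
        sumL (map (λ t → K * f t) ts) + sumL (map (λ t → m * g t) ts) + M * sumL (map h ts)
          ≈⟨ +-cong (+-cong (sumL-*ˡ K f ts) (sumL-*ˡ m g ts)) refl ⟩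
        K * sumL (map f ts) + m * sumL (map g ts) + M * sumL (map h ts) ∎

    S4-identity : ∀ n → S4Identity x q w u z n
    S4-identity n = begin
      q * (1# - w) * S
        ≈⟨ *-cong (*-cong refl (x-y≈x+m*y 1# w)) refl ⟩
      q * (1# + m * w) * S
        ≈⟨ solve 4 (λ q′ m′ w′ s → q′ :* (con 1 :+ m′ :* w′) :* s := (con 1 :+ m′ :* w′) :* (q′ :* s)) refl q m w S ⟩
      (1# + m * w) * (q * S)
        ≈⟨ *-cong refl (q*S4c n) ⟩
      (1# + m * w) * sumL (map (λ t → A t * pairWeightSum (ealm t)) ts)
        ≈⟨ sumL-*ˡ (1# + m * w) (λ t → A t * pairWeightSum (ealm t)) ts ⟨
      sumL (map (λ t → (1# + m * w) * (A t * pairWeightSum (ealm t))) ts)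
        ≈⟨ sumL-cong-∈ _ _ ts (λ {t} _ → per-sequence t) ⟩
      sumL (map (λ t → K * (A t * pow 1# (ealm t)) + m * (A t * pow w (ealm t)) + M * (A t * pow 0# (ealm t))) ts)
        ≈⟨ sumL-linear₃ (λ t → A t * pow 1# (ealm t)) (λ t → A t * pow w (ealm t)) (λ t → A t * pow 0# (ealm t)) ts ⟩
      K * sumL (map (λ t → A t * pow 1# (ealm t)) ts) + m * sumL (map (λ t → A t * pow w (ealm t)) ts)
        + M * sumL (map (λ t → A t * pow 0# (ealm t)) ts)
        ≈⟨ +-cong (+-cong (*-cong refl (oneMinusQUt-Fc 1# n)) (*-cong refl (oneMinusQUt-Fc w n))) (*-cong refl (oneMinusQUt-Fc 0# n)) ⟨
      K * O 1# + m * O w + M * O 0#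
        ≈⟨ solve 6 (λ w′ z′ m′ o₁ o o₀ →
             (w′ :+ z′ :+ m′ :* (w′ :* z′)) :* o₁ :+ m′ :* o :+ m′ :* ((z′ :+ m′ :* con 1) :* (con 1 :+ m′ :* w′)) :* o₀
             := (w′ :+ z′ :+ m′ :* (w′ :* z′)) :* o₁ :+ m′ :* o :+ m′ :* ((z′ :+ m′ :* con 1) :* (con 1 :+ m′ :* w′) :* o₀))
             refl w z m (O 1#) (O w) (O 0#) ⟩
      K * O 1# + m * O w + m * ((z + m * 1#) * (1# + m * w) * O 0#)
        ≈⟨ +-cong (+-cong (*-cong (x-y≈x+m*y (w + z) (w * z)) refl) (-x≈m*x (O w)))
                  (trans (-‿cong (*-cong (*-cong (x-y≈x+m*y z 1#) (x-y≈x+m*y 1# w)) refl)) (-x≈m*x _)) ⟨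
      (w + z - w * z) * O 1# - O w - (z - 1#) * (1# - w) * O 0#
        ∎
      where
      S  = S4c x q w u z n
      ts = ealmSeqsNonP n
      A  = weightWithoutEalm
      O : Carrier → Carrier
      O a = oneMinusQUt q u (Fc x q a u z) n
      per-sequence : ∀ t → (1# + m * w) * (A t * pairWeightSum (ealm t))
                           ≈ K * (A t * pow 1# (ealm t)) + m * (A t * pow w (ealm t)) + M * (A t * pow 0# (ealm t))
      per-sequence t = begin
        (1# + m * w) * (A t * pairWeightSum e)    ≈⟨ solve 4 (λ m′ w′ a h → (con 1 :+ m′ :* w′) :* (a :* h) := a :* ((con 1 :+ m′ :* w′) :* h)) refl m w (A t) (pairWeightSum e) ⟩
        A t * ((1# + m * w) * pairWeightSum e)    ≈⟨ *-cong refl (pairWeightSum-geometric e) ⟩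
        A t * (K * pow 1# e + m * pow w e + M * pow 0# e)
          ≈⟨ solve 7 (λ a k m′ mm p₁ p p₀ → a :* (k :* p₁ :+ m′ :* p :+ mm :* p₀) := k :* (a :* p₁) :+ m′ :* (a :* p) :+ mm :* (a :* p₀)) refl
               (A t) K m M (pow 1# e) (pow w e) (pow 0# e) ⟩
        K * (A t * pow 1# e) + m * (A t * pow w e) + M * (A t * pow 0# e) ∎
        where e = ealm t

open import Data.Nat using (ℕ; suc; _≤_; _+_; _≡ᵇ_)
open import Data.Product using (Σ; _×_; _,_; proj₁)
open import Relation.Binary.PropositionalEquality using (_≡_)
open import Function.Bundles using (_⤖_; Bijection)

lemma2p6 : ∀ {c ℓ : Level} →
    -- (i)
    ((n : ℕ) → 1 ≤ n → (i : ℕ) →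
      Σ (Dom n i ⤖ Cod n i) λ ξ → (d : Dom n i) →
        asc (proj₁ d) ≡ asc (proj₁ (proj₁ (Bijection.to ξ d)))
        × rep (proj₁ d) ≡ rep (proj₁ (proj₁ (Bijection.to ξ d)))
        × suc (maxS (proj₁ d)) ≡ maxS (proj₁ (proj₁ (Bijection.to ξ d)))
        × zeroS (proj₁ d) ≡ zeroS (proj₁ (proj₁ (Bijection.to ξ d))) + χ (i ≡ᵇ 0))
    ×
    -- (ii), coefficient of t^n, multiplied through by q(1-w)
    ((R : CommutativeRing c ℓ) (x q w u z : CommutativeRing.Carrier R) (n : ℕ) →
      GF.S4Identity R x q w u z n)
lemma2p6 = (λ n _ i → Sequences.ξ , Sequences.ξ-statistics) , Weights.S4-identity
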